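{- Let $\mathfrak{Q}$ be an $\mathscr{L}$-structure with domain $\mathbb{Q}$ such that (i) $\mathfrak{Q}$ admits some listable presentation, and (ii) the constant $0$, the successor function $S:\mathbb{Q}\to\mathbb{Q}$, $S(x)=x+1$, and the inverse function $R:\mathbb{Q}^\times\to\mathbb{Q}$, $R(x)=1/x$, are p.e. $\mathscr{L}$-definable in $\mathfrak{Q}$. Then $\mathfrak{Q}$ is uniquely listable and the function $\tau:\mathbb{N}\to\mathbb{Q}$ defined by $\tau(0)=0$, $\tau(1)=1$, $\tau(2)=-1$ and, for $n\ge3$, $\tau(n)=\tau((n-1)/2)+1$ if $n\equiv3\bmod4$, $\tau(n)=\tau(n/2)-1$ if $n\equiv0\bmod4$, $\tau(n)=1/\tau(n-2)$ if $n\equiv1,2\bmod4$, is a listable presentation of $\mathfrak{Q}$.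
   Context: All languages contain $=$, interpreted as equality. Listable means recursively enumerable. A listable presentation of a structure with domain $M$ is a surjection $\rho:\mathbb{N}\to M$ such that for each symbol the preimage of its interpretation (graph for function symbols) under the coordinatewise map induced by $\rho$ is listable. Presentations $\rho,\gamma$ are equivalent if $\gamma=\rho\circ\phi$ with $\phi:\mathbb{N}\to\mathbb{N}$ total recursive; uniquely listable means some listable presentation exists and all are equivalent. P.e. definable means definable without parameters by a formula built from atomic formulas using only $\wedge,\vee,\exists$; a constant is p.e. definable if its singleton is, a function if its graph is. (The function $\tau$ is a well-defined bijection $\mathbb{N}\to\mathbb{Q}$.) -}

module Defs where

open import Data.Nat as ℕ using (ℕ; zero; suc; _<_; _%_; _/_)
open import Data.Fin using (Fin)
open import Data.Vec using (Vec; []; _∷_; map; init; last; lookup)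
open import Data.Rational as ℚ using (ℚ; 0ℚ; 1ℚ; _+_; _-_; -_; 1/_; _≟_; ≢-nonZero)
open import Data.Product using (Σ; ∃; _×_; _,_)
open import Data.Unit using (⊤)
open import Relation.Nullary using (¬_; yes; no)
open import Relation.Binary.PropositionalEquality using (_≡_)
open import Function.Bundles using (_⇔_)

data PR : ℕ → Set where
  zeroF : ∀ {n} → PR n
  succF : PR 1
  proj  : ∀ {n} → Fin n → PR n
  comp  : ∀ {n m} → PR m → Vec (PR n) m → PR n
  prec  : ∀ {n} → PR n → PR (suc (suc n)) → PR (suc n)
  mu    : ∀ {n} → PR (suc n) → PR n

mutual
  data _[_]⇓_ : ∀ {n} → PR n → Vec ℕ n → ℕ → Set where
    ⇓zero : ∀ {n} {x : Vec ℕ n} → zeroF [ x ]⇓ 0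
    ⇓succ : ∀ {k} → succF [ k ∷ [] ]⇓ suc k
    ⇓proj : ∀ {n} {i : Fin n} {x : Vec ℕ n} → proj i [ x ]⇓ lookup x i
    ⇓comp : ∀ {n m} {f : PR m} {gs : Vec (PR n)  m} {x : Vec ℕ n} {ys : Vec ℕ m} {z : ℕ} →
            gs [ x ]⇓* ys → f [ ys ]⇓ z → comp f gs [ x ]⇓ z
    ⇓prec0 : ∀ {n} {f : PR n} {g : PR (suc (suc n))} {x : Vec ℕ n} {z : ℕ} →
             f [ x ]⇓ z → prec f g [ 0 ∷ x ]⇓ z
    ⇓precS : ∀ {n} {f : PR n} {g : PR (suc (suc n))} {x : Vec ℕ n} {k y z : ℕ} →
             prec f g [ k ∷ x ]⇓ y → g [ k ∷ y ∷ x ]⇓ z → prec f g [ suc k ∷ x ]⇓ z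
    ⇓mu : ∀ {n} {f : PR (suc n)} {x : Vec ℕ n} {y : ℕ} →
          f [ y ∷ x ]⇓ 0 →
          ((z : ℕ) → z < y → Σ ℕ (λ k → f [ z ∷ x ]⇓ suc k)) →
          mu f [ x ]⇓ y

  data _[_]⇓*_ : ∀ {n m} → Vec (PR n) m → Vec ℕ n → Vec ℕ m → Set where
    []  : ∀ {n} {x : Vec ℕ n} → [] [ x ]⇓* []
    _∷_ : ∀ {n m} {g : PR n} {gs : Vec (PR n) m} {x : Vec ℕ n} {y : ℕ} {ys : Vec ℕ m} →
          g [ x ]⇓ y → gs [ x ]⇓* ys → (g ∷ gs) [ x ]⇓* (y ∷ ys)

Listable : ∀ {k} → (Vec ℕ k → Set) → Set
Listable {k} A = Σ (PR k) (λ f → (x : Vec ℕ k) → A x ⇔ ∃ (λ y → f [ x ]⇓ y))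

TotalRecursive : (ℕ → ℕ) → Set
TotalRecursive φ = Σ (PR 1) (λ f → (n : ℕ) → f [ n ∷ [] ]⇓ φ n)

-- First-order languages and structures with domain ℚ.
-- Equality is part of every language; it is built in below.
-- Constants are 0-ary function symbols.

record Language : Set₁ where
  field
    Rel      : Set
    relArity : Rel → ℕ
    Fun      : Set
    funArity : Fun → ℕ
open Language public

record ℚStructure (L : Language) : Set₁ where
  field
    relI : (r : Rel L) → Vec ℚ (relArity L r) → Set
    funI : (f : Fun L) → Vec ℚ (funArity L f) → ℚ
open ℚStructure public

Surjective : (ℕ → ℚ) → Set
Surjective ρ = (q : ℚ) → ∃ (λ n → ρ n ≡ q)

IsListablePresentation : ∀ {L} → ℚStructure L → (ℕ → ℚ) → Set
IsListablePresentation {L} 𝔔 ρ =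
  Surjective ρ ×
  Listable {2} (λ v → ρ (lookup v Fin.zero) ≡ ρ (lookup v (Fin.suc Fin.zero))) ×
  ((r : Rel L) → Listable {relArity L r} (λ v → relI 𝔔 r (map ρ v))) ×
  ((f : Fun L) → Listable {suc (funArity L f)}
                   (λ v → funI 𝔔 f (map ρ (init v)) ≡ ρ (last v)))
  where import Data.Fin as Fin

HasListablePresentation : ∀ {L} → ℚStructure L → Set
HasListablePresentation 𝔔 = ∃ (λ ρ → IsListablePresentation 𝔔 ρ)

Equivalent : (ρ γ : ℕ → ℚ) → Set
Equivalent ρ γ = ∃ (λ φ → TotalRecursive φ × ((n : ℕ) → γ n ≡ ρ (φ n)))

UniquelyListable : ∀ {L} → ℚStructure L → Set
UniquelyListable 𝔔 =
  HasListablePresentation 𝔔 ×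
  ((ρ γ : ℕ → ℚ) → IsListablePresentation 𝔔 ρ → IsListablePresentation 𝔔 γ →
     Equivalent ρ γ)

-- Positive existential formulas (variables as de Bruijn indices Fin n).

data Term (L : Language) (n : ℕ) : Set where
  var : Fin n → Term L n
  app : (f : Fun L) → Vec (Term L n) (funArity L f) → Term L n

data PEFormula (L : Language) : ℕ → Set where
  _≐_  : ∀ {n} → Term L n → Term L n → PEFormula L n
  rel  : ∀ {n} (r : Rel L) → Vec (Term L n) (relArity L r) → PEFormula L n
  _∧_  : ∀ {n} → PEFormula L n → PEFormula L n → PEFormula L n
  _∨_  : ∀ {n} → PEFormula L n → PEFormula L n → PEFormula L n
  ∃'   : ∀ {n} → PEFormula L (suc n) → PEFormula L n

module _ {L : Language} (𝔔 : ℚStructure L) where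
  mutual
    evalT : ∀ {n} → Vec ℚ n → Term L n → ℚ
    evalT σ (var i)    = lookup σ i
    evalT σ (app f ts) = funI 𝔔 f (evalTs σ ts)

    evalTs : ∀ {n m} → Vec ℚ n → Vec (Term L n) m → Vec ℚ m
    evalTs σ []       = []
    evalTs σ (t ∷ ts) = evalT σ t ∷ evalTs σ ts

  Sat : ∀ {n} → PEFormula L n → Vec ℚ n → Set
  Sat (s ≐ t)    σ = evalT σ s ≡ evalT σ t
  Sat (rel r ts) σ = relI 𝔔 r (evalTs σ ts)
  Sat (φ ∧ ψ)    σ = Sat φ σ × Sat ψ σ
  Sat (φ ∨ ψ)    σ = Sat φ σ Data.Sum.⊎ Sat ψ σ
    where import Data.Sum
  Sat (∃' φ)     σ = Σ ℚ (λ a → Sat φ (a ∷ σ))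

  PEDefinable : ∀ {k} → (Vec ℚ k → Set) → Set
  PEDefinable {k} X = Σ (PEFormula L k) (λ φ → (σ : Vec ℚ k) → Sat φ σ ⇔ X σ)

-- total version of x ↦ 1/x (value at 0 is irrelevant; only used at x ≢ 0)
inv : ℚ → ℚ
inv p with p ≟ 0ℚ
... | yes _  = 0ℚ
... | no p≢0 = 1/_ p {{≢-nonZero p≢0}}

ZeroSet : Vec ℚ 1 → Set
ZeroSet (x ∷ []) = x ≡ 0ℚ

GraphS : Vec ℚ 2 → Set
GraphS (x ∷ y ∷ []) = y ≡ x + 1ℚ

GraphR : Vec ℚ 2 → Set
GraphR (x ∷ y ∷ []) = (¬ (x ≡ 0ℚ)) × y ≡ inv x

-- τ : ℕ → ℚ, defined by course-of-values recursion (fuel k ≥ n+1 suffices).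

τ-aux : ℕ → ℕ → ℚ
τ-step : ℕ → ℕ → ℕ → ℚ   -- fuel, n (≥ 3), n mod 4

τ-aux zero _ = 0ℚ
τ-aux (suc k) 0 = 0ℚ
τ-aux (suc k) 1 = 1ℚ
τ-aux (suc k) 2 = - 1ℚ
τ-aux (suc k) n@(suc (suc (suc m))) = τ-step k n (n % 4)

τ-step k n 3 = τ-aux k ((n ℕ.∸ 1) / 2) + 1ℚ
τ-step k n 0 = τ-aux k (n / 2) - 1ℚ
τ-step k n _ = inv (τ-aux k (n ℕ.∸ 2))

τ : ℕ → ℚ
τ n = τ-aux (suc n) n

module Submission where

open import Defs
open import Data.Empty using (⊥-elim)
open import Data.Fin as Fin using (Fin; _↑ˡ_; _↑ʳ_)
open import Data.Integer using (+_; -[1+_])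
open import Data.Nat using (ℕ; zero; suc; pred; _+_; _*_; _∸_; _%_; _/_; _⊔_; _≤_; _<_; z≤n; s≤s)
open import Data.Nat.Coprimality as Coprimality using (Coprime)
open import Data.Nat.Divisibility using (∣m∣n⇒∣m+n; ∣-refl; _∣0)
open import Data.Nat.DivMod using ([m+kn]%n≡m%n; m*n/n≡m; m/n≤m; m/n<m)
open import Data.Nat.Induction using (<-rec)
open import Data.Nat.Properties
open import Data.Product using (Σ; ∃; _×_; _,_; proj₁; proj₂)
open import Data.Rational as ℚ using (ℚ; mkℚ; 0ℚ; 1ℚ; -_)
open import Data.Rational.Properties as ℚ using (normalize-cong; normalize-coprime; neg-distrib-+)
open import Data.Sum using (_⊎_; inj₁; inj₂)
open import Data.Vec using (Vec; []; _∷_; lookup; map; tabulate; _++_; _∷ʳ_; take; drop; head; tail; init; last)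
open import Data.Vec.Properties
  using (tabulate∘lookup; tabulate-cong; tabulate-∘; map-∘; map-cong; lookup-map; init-∷ʳ; last-∷ʳ;
         ∷-injectiveˡ; ∷-injectiveʳ)
open import Function using (_∘_)
open import Function.Bundles using (_⇔_; mk⇔; Equivalence)
import Function.Properties.Equivalence as ⇔
open import Relation.Binary.Definitions using (tri<; tri≈; tri>)
open import Relation.Binary.PropositionalEquality
open import Relation.Nullary using (¬_; Dec; yes; no)

-- Fix a listable presentation ρ. Pulling positive existential formulas back along ρ gives
-- semidecidable relations on codes, so the graphs of x ↦ x + 1, x ↦ x - 1 and x ↦ 1/x (with
-- 1/0 = 0) are semidecidable on codes, and searching them yields total recursive functions S, P
-- and R on codes. Every index c ≥ 3 has a parent p(c) < c with τ(c) = τ(p(c)) + 1, τ(p(c)) - 1 or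
-- 1/τ(p(c)), so applying S, P and R down the chain of ancestors of n computes a code φ(n) of τ(n).
-- Since τ is onto ℚ (the odd indices run through the positive rationals by the Calkin–Wilf
-- descent, the even ones through their negatives), listability transfers from ρ to τ along φ.
-- Finally φ can be inverted by a search using the listable equality of ρ, so any two listable
-- presentations are equivalent to τ, hence to each other.

record Recursive (n : ℕ) : Set where
  field
    program  : PR n
    function : Vec ℕ n → ℕ
    program⇓ : ∀ x → program [ x ]⇓ function x
open Recursive public

data Expr : ℕ → Set where
  `var  : ∀ {n} → Fin n → Expr n
  `zero : ∀ {n} → Expr n
  `suc  : ∀ {n} → Expr n → Expr n
  `app  : ∀ {n m} → Expr m → Vec (Expr n) m → Expr n
  `rec  : ∀ {n} → Expr n → Expr n → Expr (suc (suc n)) → Expr n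
  `call : ∀ {n m} → Recursive m → Vec (Expr n) m → Expr n

mutual
  ⟦_⟧ : ∀ {n} → Expr n → Vec ℕ n → ℕ
  ⟦ `var i ⟧     x = lookup x i
  ⟦ `zero ⟧      x = 0
  ⟦ `suc e ⟧     x = suc (⟦ e ⟧ x)
  ⟦ `app h es ⟧  x = ⟦ h ⟧ (⟦ es ⟧* x)
  ⟦ `rec e a b ⟧ x = ⟦rec⟧ a b x (⟦ e ⟧ x)
  ⟦ `call h es ⟧ x = function h (⟦ es ⟧* x)

  ⟦_⟧* : ∀ {n m} → Vec (Expr n) m → Vec ℕ n → Vec ℕ m
  ⟦ [] ⟧*     x = []
  ⟦ e ∷ es ⟧* x = ⟦ e ⟧ x ∷ ⟦ es ⟧* x

  ⟦rec⟧ : ∀ {n} → Expr n → Expr (suc (suc n)) → Vec ℕ n → ℕ → ℕ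
  ⟦rec⟧ a b x zero    = ⟦ a ⟧ x
  ⟦rec⟧ a b x (suc k) = ⟦ b ⟧ (k ∷ ⟦rec⟧ a b x k ∷ x)

mutual
  compile : ∀ {n} → Expr n → PR n
  compile (`var i)     = proj i
  compile `zero        = zeroF
  compile (`suc e)     = comp succF (compile e ∷ [])
  compile (`app h es)  = comp (compile h) (compile* es)
  compile (`rec e a b) = comp (prec (compile a) (compile b)) (compile e ∷ tabulate proj)
  compile (`call h es) = comp (program h) (compile* es)

  compile* : ∀ {n m} → Vec (Expr n) m → Vec (PR n) m
  compile* []       = []
  compile* (e ∷ es) = compile e ∷ compile* es

projections⇓ : ∀ {n m} (σ : Fin m → Fin n) (x : Vec ℕ n) →
               tabulate (proj ∘ σ) [ x ]⇓* tabulate (lookup x ∘ σ)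
projections⇓ {m = zero}  σ x = []
projections⇓ {m = suc m} σ x = ⇓proj ∷ projections⇓ (σ ∘ Fin.suc) x

identity⇓ : ∀ {n} (x : Vec ℕ n) → tabulate proj [ x ]⇓* x
identity⇓ x = subst (tabulate proj [ x ]⇓*_) (tabulate∘lookup x) (projections⇓ (λ i → i) x)

mutual
  compile⇓ : ∀ {n} (e : Expr n) x → compile e [ x ]⇓ ⟦ e ⟧ x
  compile⇓ (`var i)     x = ⇓proj
  compile⇓ `zero        x = ⇓zero
  compile⇓ (`suc e)     x = ⇓comp (compile⇓ e x ∷ []) ⇓succ
  compile⇓ (`app h es)  x = ⇓comp (compile*⇓ es x) (compile⇓ h _)
  compile⇓ (`rec e a b) x = ⇓comp (compile⇓ e x ∷ identity⇓ x) (compile-rec⇓ a b x (⟦ e ⟧ x))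
  compile⇓ (`call h es) x = ⇓comp (compile*⇓ es x) (program⇓ h _)

  compile*⇓ : ∀ {n m} (es : Vec (Expr n) m) x → compile* es [ x ]⇓* ⟦ es ⟧* x
  compile*⇓ []       x = []
  compile*⇓ (e ∷ es) x = compile⇓ e x ∷ compile*⇓ es x

  compile-rec⇓ : ∀ {n} (a : Expr n) b x k → prec (compile a) (compile b) [ k ∷ x ]⇓ ⟦rec⟧ a b x k
  compile-rec⇓ a b x zero    = ⇓prec0 (compile⇓ a x)
  compile-rec⇓ a b x (suc k) = ⇓precS (compile-rec⇓ a b x k) (compile⇓ b _)

toRecursive : ∀ {n} → Expr n → Recursive n
toRecursive e = record { program = compile e ; function = ⟦ e ⟧ ; program⇓ = compile⇓ e }

mutual
  ⇓-deterministic : ∀ {n} {f : PR n} {x y y'} → f [ x ]⇓ y → f [ x ]⇓ y' → y ≡ y'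
  ⇓-deterministic ⇓zero ⇓zero = refl
  ⇓-deterministic ⇓succ ⇓succ = refl
  ⇓-deterministic ⇓proj ⇓proj = refl
  ⇓-deterministic (⇓comp ds d) (⇓comp ds' d') with ⇓*-deterministic ds ds'
  ... | refl = ⇓-deterministic d d'
  ⇓-deterministic (⇓prec0 d) (⇓prec0 d') = ⇓-deterministic d d'
  ⇓-deterministic (⇓precS d e) (⇓precS d' e') with ⇓-deterministic d d'
  ... | refl = ⇓-deterministic e e'
  ⇓-deterministic (⇓mu {y = y} d below) (⇓mu {y = y'} d' below') with <-cmp y y'
  ... | tri< y<y' _ _ = ⊥-elim (0≢1+n (⇓-deterministic d (proj₂ (below' y y<y'))))
  ... | tri≈ _ y≡y' _ = y≡y'
  ... | tri> _ _ y>y' = ⊥-elim (0≢1+n (⇓-deterministic d' (proj₂ (below y' y>y'))))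

  ⇓*-deterministic : ∀ {n m} {gs : Vec (PR n) m} {x ys ys'} → gs [ x ]⇓* ys → gs [ x ]⇓* ys' → ys ≡ ys'
  ⇓*-deterministic []       []         = refl
  ⇓*-deterministic (d ∷ ds) (d' ∷ ds') = cong₂ _∷_ (⇓-deterministic d d') (⇓*-deterministic ds ds')

-- firstRootFrom P z c is the first root of P among z, …, z + c ∸ 1, and z + c if there is none.
firstRootFrom : (ℕ → ℕ) → ℕ → ℕ → ℕ
firstRootFrom P z zero = z
firstRootFrom P z (suc c) with P z
... | zero  = z
... | suc _ = firstRootFrom P (suc z) c

firstRootFrom-minimal : ∀ (P : ℕ → ℕ) z c → (∀ z' → z' < z → 0 < P z') →
                        ∀ z' → z' < firstRootFrom P z c → 0 < P z'
firstRootFrom-minimal P z zero below = below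
firstRootFrom-minimal P z (suc c) below with P z in Pz
... | zero  = below
... | suc _ = firstRootFrom-minimal P (suc z) c below′
  where
  below′ : ∀ z' → z' < suc z → 0 < P z'
  below′ z' z'<1+z with m≤n⇒m<n∨m≡n (≤-pred z'<1+z)
  ... | inj₁ z'<z  = below z' z'<z
  ... | inj₂ refl rewrite Pz = s≤s z≤n

firstRootFrom-root : ∀ (P : ℕ → ℕ) z c w → P w ≡ 0 → z ≤ w → w < z + c → P (firstRootFrom P z c) ≡ 0
firstRootFrom-root P z zero w Pw z≤w w<z+0 =
  ⊥-elim (<⇒≱ w<z+0 (subst (_≤ w) (sym (+-identityʳ z)) z≤w))
firstRootFrom-root P z (suc c) w Pw z≤w w<z+c with P z in Pz
... | zero  = Pz
... | suc _ with m≤n⇒m<n∨m≡n z≤w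
...   | inj₁ z<w = firstRootFrom-root P (suc z) c w Pw z<w (subst (w <_) (+-suc z c) w<z+c)
...   | inj₂ refl = ⊥-elim (0≢1+n (trans (sym Pw) Pz))

leastRoot : (P : ℕ → ℕ) → ∃ (λ w → P w ≡ 0) → ℕ
leastRoot P (w , _) = firstRootFrom P 0 (suc w)

leastRoot-root : ∀ (P : ℕ → ℕ) root → P (leastRoot P root) ≡ 0
leastRoot-root P (w , Pw) = firstRootFrom-root P 0 (suc w) w Pw z≤n ≤-refl

leastRoot-minimal : ∀ (P : ℕ → ℕ) root z → z < leastRoot P root → 0 < P z
leastRoot-minimal P (w , _) = firstRootFrom-minimal P 0 (suc w) (λ _ ())

positive⇒suc : ∀ {n} → 0 < n → n ≡ suc (pred n)
positive⇒suc (s≤s _) = refl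

mu⇓ : ∀ {n} (h : Recursive (suc n)) x (root : ∃ λ z → function h (z ∷ x) ≡ 0) →
      mu (program h) [ x ]⇓ leastRoot (λ z → function h (z ∷ x)) root
mu⇓ h x root =
  ⇓mu (subst (program h [ leastRoot P root ∷ x ]⇓_) (leastRoot-root P root) (program⇓ h _))
      (λ z z<μ → pred (P z) , subst (program h [ z ∷ x ]⇓_)
                                    (positive⇒suc (leastRoot-minimal P root z z<μ)) (program⇓ h _))
  where
  P : ℕ → ℕ
  P z = function h (z ∷ x)

minimise : ∀ {n} (h : Recursive (suc n)) → (∀ x → ∃ λ z → function h (z ∷ x) ≡ 0) → Recursive n
minimise h roots = record
  { program  = mu (program h)
  ; function = λ x → leastRoot (λ z → function h (z ∷ x)) (roots x)
  ; program⇓ = λ x → mu⇓ h x (roots x)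
  }

minimise-root : ∀ {n} (h : Recursive (suc n)) roots x → function h (function (minimise h roots) x ∷ x) ≡ 0
minimise-root h roots x = leastRoot-root (λ z → function h (z ∷ x)) (roots x)

⟦tabulate⟧ : ∀ {n m} (f : Fin m → Expr n) x → ⟦ tabulate f ⟧* x ≡ tabulate (λ i → ⟦ f i ⟧ x)
⟦tabulate⟧ {m = zero}  f x = refl
⟦tabulate⟧ {m = suc m} f x = cong (⟦ f Fin.zero ⟧ x ∷_) (⟦tabulate⟧ (f ∘ Fin.suc) x)

take-++ : ∀ {A : Set} {k n} (ys : Vec A k) (x : Vec A n) → take k (ys ++ x) ≡ ys
take-++ []       x = refl
take-++ (y ∷ ys) x = cong (y ∷_) (take-++ ys x)

drop-++ : ∀ {A : Set} {k n} (ys : Vec A k) (x : Vec A n) → drop k (ys ++ x) ≡ x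
drop-++ []       x = refl
drop-++ (y ∷ ys) x = drop-++ ys x

lookup-↑ˡ : ∀ {A : Set} k {n} (v : Vec A (k + n)) (i : Fin k) → lookup v (i ↑ˡ n) ≡ lookup (take k v) i
lookup-↑ˡ (suc k) (a ∷ v) Fin.zero    = refl
lookup-↑ˡ (suc k) (a ∷ v) (Fin.suc i) = lookup-↑ˡ k v i

lookup-↑ʳ : ∀ {A : Set} k {n} (v : Vec A (k + n)) (j : Fin n) → lookup v (k ↑ʳ j) ≡ lookup (drop k v) j
lookup-↑ʳ zero    v       j = refl
lookup-↑ʳ (suc k) (a ∷ v) j = lookup-↑ʳ k v j

firstVars : ∀ k {n} → Vec (Expr (k + n)) k
firstVars k {n} = tabulate (λ i → `var (i ↑ˡ n))

lastVars : ∀ k {n} → Vec (Expr (k + n)) n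
lastVars k = tabulate (λ i → `var (k ↑ʳ i))

⟦firstVars⟧ : ∀ k {n} (v : Vec ℕ (k + n)) → ⟦ firstVars k ⟧* v ≡ take k v
⟦firstVars⟧ k v = trans (⟦tabulate⟧ _ v) (trans (tabulate-cong (lookup-↑ˡ k v)) (tabulate∘lookup (take k v)))

⟦lastVars⟧ : ∀ k {n} (v : Vec ℕ (k + n)) → ⟦ lastVars k ⟧* v ≡ drop k v
⟦lastVars⟧ k v = trans (⟦tabulate⟧ _ v) (trans (tabulate-cong (lookup-↑ʳ k v)) (tabulate∘lookup (drop k v)))

weaken : ∀ {n} → Expr n → Expr (suc n)
weaken e = `app e (lastVars 1)

⟦weaken⟧ : ∀ {n} (e : Expr n) w x → ⟦ weaken e ⟧ (w ∷ x) ≡ ⟦ e ⟧ x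
⟦weaken⟧ e w x = cong ⟦ e ⟧ (⟦lastVars⟧ 1 (w ∷ x))

weaken* : ∀ {n m} → Vec (Expr n) m → Vec (Expr (suc n)) m
weaken* []       = []
weaken* (e ∷ es) = weaken e ∷ weaken* es

⟦weaken*⟧ : ∀ {n m} (es : Vec (Expr n) m) w x → ⟦ weaken* es ⟧* (w ∷ x) ≡ ⟦ es ⟧* x
⟦weaken*⟧ []       w x = refl
⟦weaken*⟧ (e ∷ es) w x = cong₂ _∷_ (⟦weaken⟧ e w x) (⟦weaken*⟧ es w x)

`case : ∀ {n} → Expr n → Expr n → Expr (suc n) → Expr n
`case e a b = `rec e a (`app b (`var Fin.zero ∷ lastVars 2))

v₀ : ∀ {n} → Expr (suc n)
v₀ = `var Fin.zero

v₁ : ∀ {n} → Expr (suc (suc n))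
v₁ = `var (Fin.suc Fin.zero)

v₂ : ∀ {n} → Expr (suc (suc (suc n)))
v₂ = `var (Fin.suc (Fin.suc Fin.zero))

v₃ : ∀ {n} → Expr (suc (suc (suc (suc n))))
v₃ = `var (Fin.suc (Fin.suc (Fin.suc Fin.zero)))

v₄ : ∀ {n} → Expr (suc (suc (suc (suc (suc n)))))
v₄ = `var (Fin.suc (Fin.suc (Fin.suc (Fin.suc Fin.zero))))

-- Truth values are encoded as ℕ with 0 false and positive numbers true.
and : ℕ → ℕ → ℕ
and zero    b = 0
and (suc _) b = b

or : ℕ → ℕ → ℕ
or zero    b = b
or (suc a) b = suc a

isZero : ℕ → ℕ
isZero zero    = 1
isZero (suc _) = 0

`and : Expr 2
`and = `case v₀ `zero v₂

⟦and⟧ : ∀ a b → ⟦ `and ⟧ (a ∷ b ∷ []) ≡ and a b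
⟦and⟧ zero    b = refl
⟦and⟧ (suc a) b = refl

`or : Expr 2
`or = `case v₀ v₁ v₁

⟦or⟧ : ∀ a b → ⟦ `or ⟧ (a ∷ b ∷ []) ≡ or a b
⟦or⟧ zero    b = refl
⟦or⟧ (suc a) b = refl

`isZero : Expr 1
`isZero = `case v₀ (`suc `zero) `zero

⟦isZero⟧ : ∀ a → ⟦ `isZero ⟧ (a ∷ []) ≡ isZero a
⟦isZero⟧ zero    = refl
⟦isZero⟧ (suc a) = refl

`pred : Expr 1
`pred = `case v₀ `zero v₀

⟦pred⟧ : ∀ a → ⟦ `pred ⟧ (a ∷ []) ≡ pred a
⟦pred⟧ zero    = refl
⟦pred⟧ (suc a) = refl

and-positive : ∀ a b → 0 < and a b → 0 < a × 0 < b
and-positive (suc a) b 0<b = s≤s z≤n , 0<b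

positive-and : ∀ a b → 0 < a → 0 < b → 0 < and a b
positive-and (suc a) b _ 0<b = 0<b

or-positive : ∀ a b → 0 < or a b → 0 < a ⊎ 0 < b
or-positive zero    b 0<b = inj₂ 0<b
or-positive (suc a) b 0<a = inj₁ 0<a

positive-orˡ : ∀ a b → 0 < a → 0 < or a b
positive-orˡ (suc a) b _ = s≤s z≤n

positive-orʳ : ∀ a b → 0 < b → 0 < or a b
positive-orʳ zero    b 0<b = 0<b
positive-orʳ (suc a) b _   = s≤s z≤n

isZero≡0⇒positive : ∀ a → isZero a ≡ 0 → 0 < a
isZero≡0⇒positive (suc a) _ = s≤s z≤n

positive⇒isZero≡0 : ∀ a → 0 < a → isZero a ≡ 0
positive⇒isZero≡0 (suc a) _ = refl

-- Semidecidable relations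

-- A semidecision procedure as a total test with a stage argument; success means a positive value.
-- Monotonicity in the stage is what lets ∧ and ∃ combine tests by taking the larger stage.
record SemiDecidable {k} (A : Vec ℕ k → Set) : Set where
  field
    test          : Expr (suc k)
    test-mono     : ∀ {w w'} x → w ≤ w' → 0 < ⟦ test ⟧ (w ∷ x) → 0 < ⟦ test ⟧ (w' ∷ x)
    test-sound    : ∀ {w} x → 0 < ⟦ test ⟧ (w ∷ x) → A x
    test-complete : ∀ x → A x → ∃ λ w → 0 < ⟦ test ⟧ (w ∷ x)
open SemiDecidable public

semidec-resp : ∀ {k} {A B : Vec ℕ k → Set} → (∀ x → A x → B x) → (∀ x → B x → A x) →
               SemiDecidable A → SemiDecidable B
semidec-resp A⇒B B⇒A s = record
  { test = test s ; test-mono = test-mono s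
  ; test-sound = λ x t → A⇒B x (test-sound s x t) ; test-complete = λ x b → test-complete s x (B⇒A x b) }

semidec-cong : ∀ {k} {X : Set} (P : X → Set) {f g : Vec ℕ k → X} → (∀ v → f v ≡ g v) →
               SemiDecidable (P ∘ f) → SemiDecidable (P ∘ g)
semidec-cong P f≗g = semidec-resp (λ v → subst P (f≗g v)) (λ v → subst P (sym (f≗g v)))

semidec-⊤ : ∀ {k} {A : Vec ℕ k → Set} → (∀ x → A x) → SemiDecidable A
semidec-⊤ a = record
  { test = `suc `zero ; test-mono = λ _ _ _ → s≤s z≤n
  ; test-sound = λ x _ → a x ; test-complete = λ x _ → 0 , s≤s z≤n }

∧-semidec : ∀ {k} {A B : Vec ℕ k → Set} → SemiDecidable A → SemiDecidable B →
            SemiDecidable (λ x → A x × B x)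
∧-semidec {k} {A} {B} s t = record
  { test = T ; test-mono = λ {w} {w'} → mono {w} {w'} ; test-sound = λ {w} → sound {w} ; test-complete = complete }
  where
  T : Expr (suc k)
  T = `app `and (test s ∷ test t ∷ [])
  both : ∀ w x → 0 < ⟦ T ⟧ (w ∷ x) → 0 < ⟦ test s ⟧ (w ∷ x) × 0 < ⟦ test t ⟧ (w ∷ x)
  both w x p = and-positive _ _ (subst (0 <_) (⟦and⟧ (⟦ test s ⟧ (w ∷ x)) (⟦ test t ⟧ (w ∷ x))) p)
  succeeds : ∀ w x → 0 < ⟦ test s ⟧ (w ∷ x) → 0 < ⟦ test t ⟧ (w ∷ x) → 0 < ⟦ T ⟧ (w ∷ x)
  succeeds w x p q = subst (0 <_) (sym (⟦and⟧ (⟦ test s ⟧ (w ∷ x)) (⟦ test t ⟧ (w ∷ x)))) (positive-and _ _ p q)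
  mono : ∀ {w w'} x → w ≤ w' → 0 < ⟦ T ⟧ (w ∷ x) → 0 < ⟦ T ⟧ (w' ∷ x)
  mono {w} {w'} x w≤w' p with both w x p
  ... | p₁ , p₂ = succeeds w' x (test-mono s x w≤w' p₁) (test-mono t x w≤w' p₂)
  sound : ∀ {w} x → 0 < ⟦ T ⟧ (w ∷ x) → A x × B x
  sound {w} x p with both w x p
  ... | p₁ , p₂ = test-sound s x p₁ , test-sound t x p₂
  complete : ∀ x → A x × B x → ∃ λ w → 0 < ⟦ T ⟧ (w ∷ x)
  complete x (a , b) with test-complete s x a | test-complete t x b
  ... | w₁ , p₁ | w₂ , p₂ =
    w₁ ⊔ w₂ , succeeds _ x (test-mono s x (m≤m⊔n w₁ w₂) p₁) (test-mono t x (m≤n⊔m w₁ w₂) p₂)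

∨-semidec : ∀ {k} {A B : Vec ℕ k → Set} → SemiDecidable A → SemiDecidable B →
            SemiDecidable (λ x → A x ⊎ B x)
∨-semidec {k} {A} {B} s t = record
  { test = T ; test-mono = λ {w} {w'} → mono {w} {w'} ; test-sound = λ {w} → sound {w} ; test-complete = complete }
  where
  T : Expr (suc k)
  T = `app `or (test s ∷ test t ∷ [])
  either : ∀ w x → 0 < ⟦ T ⟧ (w ∷ x) → 0 < ⟦ test s ⟧ (w ∷ x) ⊎ 0 < ⟦ test t ⟧ (w ∷ x)
  either w x p = or-positive _ _ (subst (0 <_) (⟦or⟧ (⟦ test s ⟧ (w ∷ x)) (⟦ test t ⟧ (w ∷ x))) p)
  succeedsˡ : ∀ w x → 0 < ⟦ test s ⟧ (w ∷ x) → 0 < ⟦ T ⟧ (w ∷ x)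
  succeedsˡ w x p = subst (0 <_) (sym (⟦or⟧ (⟦ test s ⟧ (w ∷ x)) (⟦ test t ⟧ (w ∷ x)))) (positive-orˡ _ _ p)
  succeedsʳ : ∀ w x → 0 < ⟦ test t ⟧ (w ∷ x) → 0 < ⟦ T ⟧ (w ∷ x)
  succeedsʳ w x p =
    subst (0 <_) (sym (⟦or⟧ (⟦ test s ⟧ (w ∷ x)) (⟦ test t ⟧ (w ∷ x)))) (positive-orʳ (⟦ test s ⟧ (w ∷ x)) _ p)
  mono : ∀ {w w'} x → w ≤ w' → 0 < ⟦ T ⟧ (w ∷ x) → 0 < ⟦ T ⟧ (w' ∷ x)
  mono {w} {w'} x w≤w' p with either w x p
  ... | inj₁ p₁ = succeedsˡ w' x (test-mono s x w≤w' p₁)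
  ... | inj₂ p₂ = succeedsʳ w' x (test-mono t x w≤w' p₂)
  sound : ∀ {w} x → 0 < ⟦ T ⟧ (w ∷ x) → A x ⊎ B x
  sound {w} x p with either w x p
  ... | inj₁ p₁ = inj₁ (test-sound s x p₁)
  ... | inj₂ p₂ = inj₂ (test-sound t x p₂)
  complete : ∀ x → A x ⊎ B x → ∃ λ w → 0 < ⟦ T ⟧ (w ∷ x)
  complete x (inj₁ a) with test-complete s x a
  ... | w , p = w , succeedsˡ w x p
  complete x (inj₂ b) with test-complete t x b
  ... | w , p = w , succeedsʳ w x p

semidec-∘ : ∀ {n m} {B : Vec ℕ m → Set} → SemiDecidable B →
            (es : Vec (Expr n) m) (g : Vec ℕ n → Vec ℕ m) → (∀ x → ⟦ es ⟧* x ≡ g x) →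
            SemiDecidable (B ∘ g)
semidec-∘ {n} {m} {B} s es g ⟦es⟧≡g = record
  { test = T ; test-mono = λ {w} {w'} → mono {w} {w'} ; test-sound = λ {w} → sound {w} ; test-complete = complete }
  where
  T : Expr (suc n)
  T = `app (test s) (v₀ ∷ weaken* es)
  ⟦T⟧ : ∀ w x → ⟦ T ⟧ (w ∷ x) ≡ ⟦ test s ⟧ (w ∷ g x)
  ⟦T⟧ w x = cong (λ v → ⟦ test s ⟧ (w ∷ v)) (trans (⟦weaken*⟧ es w x) (⟦es⟧≡g x))
  mono : ∀ {w w'} x → w ≤ w' → 0 < ⟦ T ⟧ (w ∷ x) → 0 < ⟦ T ⟧ (w' ∷ x)
  mono {w} {w'} x w≤w' p = subst (0 <_) (sym (⟦T⟧ w' x)) (test-mono s (g x) w≤w' (subst (0 <_) (⟦T⟧ w x) p))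
  sound : ∀ {w} x → 0 < ⟦ T ⟧ (w ∷ x) → B (g x)
  sound {w} x p = test-sound s (g x) (subst (0 <_) (⟦T⟧ w x) p)
  complete : ∀ x → B (g x) → ∃ λ w → 0 < ⟦ T ⟧ (w ∷ x)
  complete x b with test-complete s (g x) b
  ... | w , p = w , subst (0 <_) (sym (⟦T⟧ w x)) p

-- anyStep C folds `or` over the witnesses j, with the stage w fixed: environment (j ∷ acc ∷ w ∷ x).
anyStep : ∀ {k} → Expr (suc (suc k)) → Expr (suc (suc (suc k)))
anyStep C = `app `or (v₁ ∷ `app C (v₂ ∷ v₀ ∷ lastVars 3) ∷ [])

anyBelow : ∀ {k} → Expr (suc (suc k)) → Vec ℕ (suc k) → ℕ → ℕ
anyBelow C = ⟦rec⟧ `zero (anyStep C)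

anyBelow-suc : ∀ {k} (C : Expr (suc (suc k))) w x j →
               anyBelow C (w ∷ x) (suc j) ≡ or (anyBelow C (w ∷ x) j) (⟦ C ⟧ (w ∷ j ∷ x))
anyBelow-suc C w x j =
  trans (⟦or⟧ acc _) (cong (λ v → or acc (⟦ C ⟧ (w ∷ j ∷ v))) (⟦lastVars⟧ 3 (j ∷ acc ∷ w ∷ x)))
  where
  acc : ℕ
  acc = anyBelow C (w ∷ x) j

anyBelow-sound : ∀ {k} (C : Expr (suc (suc k))) w x j → 0 < anyBelow C (w ∷ x) j →
                 ∃ λ y → y < j × 0 < ⟦ C ⟧ (w ∷ y ∷ x)
anyBelow-sound C w x zero ()
anyBelow-sound C w x (suc j) p with or-positive _ _ (subst (0 <_) (anyBelow-suc C w x j) p)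
... | inj₁ p₁ with anyBelow-sound C w x j p₁
...   | y , y<j , q = y , m≤n⇒m≤1+n y<j , q
anyBelow-sound C w x (suc j) p | inj₂ p₂ = j , ≤-refl , p₂

anyBelow-complete : ∀ {k} (C : Expr (suc (suc k))) w x j y → y < j → 0 < ⟦ C ⟧ (w ∷ y ∷ x) →
                    0 < anyBelow C (w ∷ x) j
anyBelow-complete C w x (suc j) y y<1+j q with m≤n⇒m<n∨m≡n (≤-pred y<1+j)
... | inj₁ y<j = subst (0 <_) (sym (anyBelow-suc C w x j))
                       (positive-orˡ _ _ (anyBelow-complete C w x j y y<j q))
... | inj₂ refl = subst (0 <_) (sym (anyBelow-suc C w x j)) (positive-orʳ (anyBelow C (w ∷ x) y) _ q)

-- The test at stage w looks for a witness y ≤ w whose test succeeds at stage w.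
∃-semidec : ∀ {k} {B : Vec ℕ (suc k) → Set} → SemiDecidable B → SemiDecidable (λ x → ∃ λ y → B (y ∷ x))
∃-semidec {k} {B} s = record
  { test = `rec (`suc v₀) `zero (anyStep (test s))
  ; test-mono = λ {w} {w'} → mono {w} {w'} ; test-sound = λ {w} → sound {w} ; test-complete = complete }
  where
  mono : ∀ {w w'} x → w ≤ w' → 0 < anyBelow (test s) (w ∷ x) (suc w) → 0 < anyBelow (test s) (w' ∷ x) (suc w')
  mono {w} {w'} x w≤w' p with anyBelow-sound (test s) w x (suc w) p
  ... | y , y≤w , q = anyBelow-complete (test s) w' x (suc w') y (≤-trans y≤w (s≤s w≤w')) (test-mono s (y ∷ x) w≤w' q)
  sound : ∀ {w} x → 0 < anyBelow (test s) (w ∷ x) (suc w) → ∃ λ y → B (y ∷ x)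
  sound {w} x p with anyBelow-sound (test s) w x (suc w) p
  ... | y , _ , q = y , test-sound s (y ∷ x) q
  complete : ∀ x → (∃ λ y → B (y ∷ x)) → ∃ λ w → 0 < anyBelow (test s) (w ∷ x) (suc w)
  complete x (y , b) with test-complete s (y ∷ x) b
  ... | w , q = w ⊔ y , anyBelow-complete (test s) (w ⊔ y) x (suc (w ⊔ y)) y (s≤s (m≤n⊔m w y))
                                           (test-mono s (y ∷ x) (m≤m⊔n w y) q)

∃ⁿ-semidec : ∀ k {n} {B : Vec ℕ (k + n) → Set} → SemiDecidable B →
             SemiDecidable {n} (λ x → ∃ λ (ys : Vec ℕ k) → B (ys ++ x))
∃ⁿ-semidec zero    s = semidec-resp (λ x b → [] , b) (λ { x ([] , b) → b }) s
∃ⁿ-semidec (suc k) s = semidec-resp (λ { x (ys , y , b) → (y ∷ ys) , b }) (λ { x ((y ∷ ys) , b) → ys , y , b })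
                                    (∃ⁿ-semidec k (∃-semidec s))

firstSuccess : ∀ {n} (e : Expr (suc n)) → (∀ x → ∃ λ y → 0 < ⟦ e ⟧ (y ∷ x)) →
               Σ (Recursive n) λ F → ∀ x → 0 < ⟦ e ⟧ (function F x ∷ x)
firstSuccess {n} e succeeds = F , λ x → isZero≡0⇒positive _ (trans (sym (⟦isZero⟧ _)) (minimise-root h roots x))
  where
  h : Recursive (suc n)
  h = toRecursive (`app `isZero (e ∷ []))
  roots : ∀ x → ∃ λ z → function h (z ∷ x) ≡ 0
  roots x with succeeds x
  ... | y , p = y , trans (⟦isZero⟧ _) (positive⇒isZero≡0 _ p)
  F : Recursive n
  F = minimise h roots

semidec⇒listable : ∀ {k} {A : Vec ℕ k → Set} → SemiDecidable A → Listable A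
semidec⇒listable {k} {A} s = mu (program h) , λ x → mk⇔ (halts x) (holds x)
  where
  h : Recursive (suc k)
  h = toRecursive (`app `isZero (test s ∷ []))
  halts : ∀ x → A x → ∃ λ y → mu (program h) [ x ]⇓ y
  halts x a with test-complete s x a
  ... | w , p = _ , mu⇓ h x (w , trans (⟦isZero⟧ _) (positive⇒isZero≡0 _ p))
  holds : ∀ x → (∃ λ y → mu (program h) [ x ]⇓ y) → A x
  holds x (y , ⇓mu d _) =
    test-sound s x (isZero≡0⇒positive _ (trans (sym (⟦isZero⟧ _)) (sym (⇓-deterministic d (program⇓ h (y ∷ x))))))

-- First find a stage at which some witness succeeds, then the least witness succeeding at that stage.
select : ∀ {k} {A : Vec ℕ (suc k) → Set} → SemiDecidable A → (∀ x → ∃ λ y → A (y ∷ x)) →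
         Σ (Recursive k) λ K → ∀ x → A (function K x ∷ x)
select {k} {A} s total = K , λ x → test-sound s _ (subst (0 <_) (⟦C⟧ (function K x) x) (K-succeeds x))
  where
  stage : Σ (Recursive k) λ W → ∀ x → 0 < ⟦ test (∃-semidec s) ⟧ (function W x ∷ x)
  stage = firstSuccess (test (∃-semidec s)) (λ x → test-complete (∃-semidec s) x (total x))
  W : Recursive k
  W = proj₁ stage
  C : Expr (suc k)
  C = `app (test s) (`call W (lastVars 1) ∷ v₀ ∷ lastVars 1)
  ⟦C⟧ : ∀ y x → ⟦ C ⟧ (y ∷ x) ≡ ⟦ test s ⟧ (function W x ∷ y ∷ x)
  ⟦C⟧ y x = cong (λ v → ⟦ test s ⟧ (function W v ∷ y ∷ v)) (⟦lastVars⟧ 1 (y ∷ x))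
  witness : ∀ x → ∃ λ y → 0 < ⟦ C ⟧ (y ∷ x)
  witness x with anyBelow-sound (test s) (function W x) x (suc (function W x)) (proj₂ stage x)
  ... | y , _ , p = y , subst (0 <_) (sym (⟦C⟧ y x)) p
  K : Recursive k
  K = proj₁ (firstSuccess C witness)
  K-succeeds : ∀ x → 0 < ⟦ C ⟧ (function K x ∷ x)
  K-succeeds = proj₂ (firstSuccess C witness)

-- A clocked interpreter for PR

allHalted : ∀ {m} → Vec ℕ m → ℕ
allHalted []       = 1
allHalted (y ∷ ys) = and y (allHalted ys)

-- The state of a μ-search: 0 = an earlier value did not halt in time, 1 = still searching,
-- suc (suc i) = the least root is i.  The value v is the (clocked) result at the current index i.
searchStep : ℕ → ℕ → ℕ → ℕ
searchStep zero                 v               i = 0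
searchStep (suc zero)           zero            i = 0
searchStep (suc zero)           (suc zero)      i = suc (suc i)
searchStep (suc zero)           (suc (suc _))   i = 1
searchStep (suc (suc q))        v               i = suc (suc q)

-- run t f x is 0 if f has not halted on x within clock t and suc y if it halted with output y;
-- the clock bounds the length of every μ-search.
mutual
  run : ∀ {n} → ℕ → PR n → Vec ℕ n → ℕ
  run t zeroF       x       = 1
  run t succF       (k ∷ []) = suc (suc k)
  run t (proj i)    x       = suc (lookup x i)
  run t (comp f gs) x       = and (allHalted (run* t gs x)) (run t f (map pred (run* t gs x)))
  run t (prec f g)  (k ∷ x) = runPrec t f g k x
  run t (mu f)      x       = pred (runSearch t f x t)

  run* : ∀ {n m} → ℕ → Vec (PR n) m → Vec ℕ n → Vec ℕ m
  run* t []       x = []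
  run* t (g ∷ gs) x = run t g x ∷ run* t gs x

  runPrec : ∀ {n} → ℕ → PR n → PR (suc (suc n)) → ℕ → Vec ℕ n → ℕ
  runPrec t f g zero    x = run t f x
  runPrec t f g (suc k) x = and (runPrec t f g k x) (run t g (k ∷ pred (runPrec t f g k x) ∷ x))

  runSearch : ∀ {n} → ℕ → PR (suc n) → Vec ℕ n → ℕ → ℕ
  runSearch t f x zero    = 1
  runSearch t f x (suc i) = searchStep (runSearch t f x i) (run t f (i ∷ x)) i

and≡suc : ∀ a b {y} → and a b ≡ suc y → a ≡ suc (pred a) × b ≡ suc y
and≡suc (suc a) b b≡1+y = refl , b≡1+y

pred≡suc : ∀ {a y} → pred a ≡ suc y → a ≡ suc (suc y)
pred≡suc {suc a} refl = refl

mutual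
  run-sound : ∀ {n} t (f : PR n) x {y} → run t f x ≡ suc y → f [ x ]⇓ y
  run-sound t zeroF       x        refl = ⇓zero
  run-sound t succF       (k ∷ []) refl = ⇓succ
  run-sound t (proj i)    x        refl = ⇓proj
  run-sound t (comp f gs) x        eq with and≡suc (allHalted (run* t gs x)) _ eq
  ... | halted , f-halts = ⇓comp (run*-sound t gs x (subst (0 <_) (sym halted) (s≤s z≤n))) (run-sound t f _ f-halts)
  run-sound t (prec f g)  (k ∷ x)  eq = runPrec-sound t f g k x eq
  run-sound t (mu f)      x        eq = runSearch-sound t f x t (pred≡suc eq)

  run*-sound : ∀ {n m} t (gs : Vec (PR n) m) x → 0 < allHalted (run* t gs x) →
               gs [ x ]⇓* map pred (run* t gs x)
  run*-sound t []       x p = []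
  run*-sound t (g ∷ gs) x p with run t g x in eq
  ... | suc v = run-sound t g x eq ∷ run*-sound t gs x p

  runPrec-sound : ∀ {n} t (f : PR n) g k x {y} → runPrec t f g k x ≡ suc y → prec f g [ k ∷ x ]⇓ y
  runPrec-sound t f g zero    x eq = ⇓prec0 (run-sound t f x eq)
  runPrec-sound t f g (suc k) x eq with and≡suc (runPrec t f g k x) _ eq
  ... | e₁ , e₂ = ⇓precS (runPrec-sound t f g k x e₁) (run-sound t g _ e₂)

  runSearch-searching : ∀ {n} t (f : PR (suc n)) x i → runSearch t f x i ≡ 1 →
                        ∀ z → z < i → ∃ λ k → f [ z ∷ x ]⇓ suc k
  runSearch-searching t f x (suc i) eq z z<1+i with runSearch t f x i in e₁ | run t f (i ∷ x) in e₂
  ... | suc zero | suc (suc k) with m≤n⇒m<n∨m≡n (≤-pred z<1+i)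
  ...   | inj₁ z<i  = runSearch-searching t f x i e₁ z z<i
  ...   | inj₂ refl = k , run-sound t f (z ∷ x) e₂
  runSearch-searching t f x (suc i) () z z<1+i | zero        | _
  runSearch-searching t f x (suc i) () z z<1+i | suc zero    | zero
  runSearch-searching t f x (suc i) () z z<1+i | suc zero    | suc zero
  runSearch-searching t f x (suc i) () z z<1+i | suc (suc q) | _

  runSearch-sound : ∀ {n} t (f : PR (suc n)) x i {y} → runSearch t f x i ≡ suc (suc y) → mu f [ x ]⇓ y
  runSearch-sound t f x (suc i) eq with runSearch t f x i in e₁ | run t f (i ∷ x) in e₂
  runSearch-sound t f x (suc i) refl | suc zero    | suc zero =
    ⇓mu (run-sound t f (i ∷ x) e₂) (runSearch-searching t f x i e₁)
  runSearch-sound t f x (suc i) refl | suc (suc q) | _        = runSearch-sound t f x i e₁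
  runSearch-sound t f x (suc i) ()   | zero        | _
  runSearch-sound t f x (suc i) ()   | suc zero    | zero
  runSearch-sound t f x (suc i) ()   | suc zero    | suc (suc _)

0<a⇒and[a,b]≡b : ∀ a b → 0 < a → and a b ≡ b
0<a⇒and[a,b]≡b (suc a) b _ = refl

allHalted-∷ : ∀ {m} y (ys : Vec ℕ m) → 0 < and y (allHalted ys) → y ≡ suc (pred y) × 0 < allHalted ys
allHalted-∷ (suc y) ys p = refl , p

runSearch-found-stable : ∀ {n} t (f : PR (suc n)) x d i {z} → runSearch t f x i ≡ suc (suc z) →
                         runSearch t f x (d + i) ≡ suc (suc z)
runSearch-found-stable t f x zero    i eq = eq
runSearch-found-stable t f x (suc d) i eq rewrite runSearch-found-stable t f x d i eq = refl

mutual
  run-mono : ∀ {n} {t t'} (f : PR n) x {y} → t ≤ t' → run t f x ≡ suc y → run t' f x ≡ suc y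
  run-mono zeroF       x        t≤t' eq = eq
  run-mono succF       (k ∷ []) t≤t' eq = eq
  run-mono (proj i)    x        t≤t' eq = eq
  run-mono {t = t} (comp f gs) x t≤t' eq with and≡suc (allHalted (run* t gs x)) _ eq
  ... | halted , f-halts rewrite run*-mono gs x t≤t' (subst (0 <_) (sym halted) (s≤s z≤n)) =
    trans (0<a⇒and[a,b]≡b _ _ (subst (0 <_) (sym halted) (s≤s z≤n))) (run-mono f _ t≤t' f-halts)
  run-mono (prec f g)  (k ∷ x)  t≤t' eq = runPrec-mono f g k x t≤t' eq
  run-mono {t = t} {t'} (mu f) x t≤t' eq = cong pred (begin
    runSearch t' f x t'              ≡⟨ cong (runSearch t' f x) (sym (m∸n+n≡m t≤t')) ⟩
    runSearch t' f x (t' ∸ t + t)    ≡⟨ runSearch-found-stable t' f x (t' ∸ t) t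
                                          (runSearch-mono f x t t≤t' (pred≡suc eq)) ⟩
    suc (suc _)                      ∎)
    where open ≡-Reasoning

  run*-mono : ∀ {n m} {t t'} (gs : Vec (PR n) m) x → t ≤ t' → 0 < allHalted (run* t gs x) →
              run* t' gs x ≡ run* t gs x
  run*-mono []       x t≤t' p = refl
  run*-mono {t = t} (g ∷ gs) x t≤t' p with allHalted-∷ (run t g x) (run* t gs x) p
  ... | g-halts , rest = cong₂ _∷_ (trans (run-mono g x t≤t' g-halts) (sym g-halts)) (run*-mono gs x t≤t' rest)

  runPrec-mono : ∀ {n} {t t'} (f : PR n) g k x {y} → t ≤ t' →
                 runPrec t f g k x ≡ suc y → runPrec t' f g k x ≡ suc y
  runPrec-mono f g zero x t≤t' eq = run-mono f x t≤t' eq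
  runPrec-mono {t = t} f g (suc k) x t≤t' eq with and≡suc (runPrec t f g k x) _ eq
  ... | e₁ , e₂ rewrite runPrec-mono f g k x t≤t' e₁ = run-mono g _ t≤t' e₂

  runSearch-mono : ∀ {n} {t t'} (f : PR (suc n)) x i {s} → t ≤ t' →
                   runSearch t f x i ≡ suc s → runSearch t' f x i ≡ suc s
  runSearch-mono f x zero t≤t' eq = eq
  runSearch-mono {t = t} f x (suc i) t≤t' eq with runSearch t f x i in e₁ | run t f (i ∷ x) in e₂
  ... | suc zero    | suc v rewrite runSearch-mono f x i t≤t' e₁ | run-mono f (i ∷ x) t≤t' e₂ = eq
  ... | suc (suc q) | _     rewrite runSearch-mono f x i t≤t' e₁ = eq

allHalted-map-suc : ∀ {m} (ys : Vec ℕ m) → allHalted (map suc ys) ≡ 1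
allHalted-map-suc []       = refl
allHalted-map-suc (y ∷ ys) = allHalted-map-suc ys

map-pred-suc : ∀ {m} (ys : Vec ℕ m) → map pred (map suc ys) ≡ ys
map-pred-suc []       = refl
map-pred-suc (y ∷ ys) = cong (y ∷_) (map-pred-suc ys)

run*-mono-halted : ∀ {n m} {t t'} (gs : Vec (PR n) m) x ys → t ≤ t' →
                   run* t gs x ≡ map suc ys → run* t' gs x ≡ map suc ys
run*-mono-halted {t = t} gs x ys t≤t' eq = trans (run*-mono gs x t≤t' halted) eq
  where
  halted : 0 < allHalted (run* t gs x)
  halted rewrite eq | allHalted-map-suc ys = s≤s z≤n

mutual
  run-complete : ∀ {n} {f : PR n} {x y} → f [ x ]⇓ y → ∃ λ t → run t f x ≡ suc y
  run-complete ⇓zero = 0 , refl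
  run-complete ⇓succ = 0 , refl
  run-complete ⇓proj = 0 , refl
  run-complete (⇓comp {f = f} {gs = gs} {x = x} {ys = ys} ds d) with run*-complete ds | run-complete d
  ... | t₁ , e₁ | t₂ , e₂ = t₁ ⊔ t₂ , goal
    where
    goal : run (t₁ ⊔ t₂) (comp f gs) x ≡ suc _
    goal rewrite run*-mono-halted gs x ys (m≤m⊔n t₁ t₂) e₁ | allHalted-map-suc ys | map-pred-suc ys =
      run-mono f ys (m≤n⊔m t₁ t₂) e₂
  run-complete (⇓prec0 d) = run-complete d
  run-complete (⇓precS {f = f} {g = g} {x = x} {k = k} d e) with run-complete d | run-complete e
  ... | t₁ , e₁ | t₂ , e₂ = t₁ ⊔ t₂ , goal
    where
    goal : runPrec (t₁ ⊔ t₂) f g (suc k) x ≡ suc _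
    goal rewrite runPrec-mono f g k x (m≤m⊔n t₁ t₂) e₁ = run-mono g _ (m≤n⊔m t₁ t₂) e₂
  run-complete (⇓mu {f = f} {x = x} {y = y} d below) with run-complete d | search-complete f x y below
  ... | t₀ , e₀ | t₁ , nonroots = T , cong pred found
    where
    T : ℕ
    T = (t₀ ⊔ t₁) ⊔ suc y
    t₀≤T : t₀ ≤ T
    t₀≤T = ≤-trans (m≤m⊔n t₀ t₁) (m≤m⊔n _ _)
    t₁≤T : t₁ ≤ T
    t₁≤T = ≤-trans (m≤n⊔m t₀ t₁) (m≤m⊔n _ _)
    searching : ∀ i → i ≤ y → runSearch T f x i ≡ 1
    searching zero    _   = refl
    searching (suc i) i<y with nonroots i i<y
    ... | k , ek rewrite searching i (≤-trans (n≤1+n i) i<y) | run-mono f (i ∷ x) t₁≤T ek = refl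
    found-at-y : runSearch T f x (suc y) ≡ suc (suc y)
    found-at-y rewrite searching y ≤-refl | run-mono f (y ∷ x) t₀≤T e₀ = refl
    found : runSearch T f x T ≡ suc (suc y)
    found = trans (cong (runSearch T f x) (sym (m∸n+n≡m (m≤n⊔m (t₀ ⊔ t₁) (suc y)))))
                  (runSearch-found-stable T f x (T ∸ suc y) (suc y) found-at-y)

  run*-complete : ∀ {n m} {gs : Vec (PR n) m} {x ys} → gs [ x ]⇓* ys → ∃ λ t → run* t gs x ≡ map suc ys
  run*-complete [] = 0 , refl
  run*-complete {gs = g ∷ gs} {x = x} {ys = y ∷ ys} (d ∷ ds) with run-complete d | run*-complete ds
  ... | t₁ , e₁ | t₂ , e₂ =
    t₁ ⊔ t₂ , cong₂ _∷_ (run-mono g x (m≤m⊔n t₁ t₂) e₁) (run*-mono-halted gs x ys (m≤n⊔m t₁ t₂) e₂)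

  search-complete : ∀ {n} (f : PR (suc n)) x y → (∀ z → z < y → ∃ λ k → f [ z ∷ x ]⇓ suc k) →
                    ∃ λ t → ∀ z → z < y → ∃ λ k → run t f (z ∷ x) ≡ suc (suc k)
  search-complete f x zero    below = 0 , λ z ()
  search-complete f x (suc y) below with search-complete f x y (λ z z<y → below z (m≤n⇒m≤1+n z<y)) | below y ≤-refl
  ... | t₁ , nonroots | k , dk with run-complete dk
  ...   | t₂ , e₂ = t₁ ⊔ t₂ , nonroots′
    where
    nonroots′ : ∀ z → z < suc y → ∃ λ k → run (t₁ ⊔ t₂) f (z ∷ x) ≡ suc (suc k)
    nonroots′ z z<1+y with m≤n⇒m<n∨m≡n (≤-pred z<1+y)
    ... | inj₁ z<y  = let (k′ , e) = nonroots z z<y in k′ , run-mono f (z ∷ x) (m≤m⊔n t₁ t₂) e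
    ... | inj₂ refl = k , run-mono f (z ∷ x) (m≤n⊔m t₁ t₂) e₂

`allHalted : ∀ {n m} → Vec (Expr n) m → Expr n
`allHalted []       = `suc `zero
`allHalted (e ∷ es) = `app `and (e ∷ `allHalted es ∷ [])

⟦allHalted⟧ : ∀ {n m} (es : Vec (Expr n) m) x → ⟦ `allHalted es ⟧ x ≡ allHalted (⟦ es ⟧* x)
⟦allHalted⟧ []       x = refl
⟦allHalted⟧ (e ∷ es) x = trans (⟦and⟧ (⟦ e ⟧ x) _) (cong (and (⟦ e ⟧ x)) (⟦allHalted⟧ es x))

`pred* : ∀ {n m} → Vec (Expr n) m → Vec (Expr n) m
`pred* []       = []
`pred* (e ∷ es) = `app `pred (e ∷ []) ∷ `pred* es

⟦pred*⟧ : ∀ {n m} (es : Vec (Expr n) m) x → ⟦ `pred* es ⟧* x ≡ map pred (⟦ es ⟧* x)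
⟦pred*⟧ []       x = refl
⟦pred*⟧ (e ∷ es) x = cong₂ _∷_ (⟦pred⟧ (⟦ e ⟧ x)) (⟦pred*⟧ es x)

`searchStep : Expr 3
`searchStep = `case v₀ `zero (`case v₀ (`case v₂ `zero (`case v₀ (`suc (`suc v₄)) (`suc `zero))) (`suc (`suc v₀)))

⟦searchStep⟧ : ∀ q v i → ⟦ `searchStep ⟧ (q ∷ v ∷ i ∷ []) ≡ searchStep q v i
⟦searchStep⟧ zero          v             i = refl
⟦searchStep⟧ (suc zero)    zero          i = refl
⟦searchStep⟧ (suc zero)    (suc zero)    i = refl
⟦searchStep⟧ (suc zero)    (suc (suc v)) i = refl
⟦searchStep⟧ (suc (suc q)) v             i = refl

-- Environments of the two recursion steps below: (k ∷ acc ∷ t ∷ k₀ ∷ x) and (i ∷ acc ∷ t ∷ x).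
precStep : ∀ {n} → Expr (suc (suc (suc n))) → Expr (suc (suc (suc (suc n))))
precStep g = `app `and (v₁ ∷ `app g (v₂ ∷ v₀ ∷ `app `pred (v₁ ∷ []) ∷ lastVars 4) ∷ [])

⟦precStep⟧ : ∀ {n} (g : Expr (suc (suc (suc n)))) t k₀ x k acc →
             ⟦ precStep g ⟧ (k ∷ acc ∷ t ∷ k₀ ∷ x) ≡ and acc (⟦ g ⟧ (t ∷ k ∷ pred acc ∷ x))
⟦precStep⟧ g t k₀ x k acc =
  trans (⟦and⟧ acc _)
        (cong (and acc) (cong₂ (λ p v → ⟦ g ⟧ (t ∷ k ∷ p ∷ v)) (⟦pred⟧ acc) (⟦lastVars⟧ 4 (k ∷ acc ∷ t ∷ k₀ ∷ x))))

searchStepWith : ∀ {n} → Expr (suc (suc n)) → Expr (suc (suc (suc n)))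
searchStepWith f = `app `searchStep (v₁ ∷ `app f (v₂ ∷ v₀ ∷ lastVars 3) ∷ v₀ ∷ [])

⟦searchStepWith⟧ : ∀ {n} (f : Expr (suc (suc n))) t x i acc →
                   ⟦ searchStepWith f ⟧ (i ∷ acc ∷ t ∷ x) ≡ searchStep acc (⟦ f ⟧ (t ∷ i ∷ x)) i
⟦searchStepWith⟧ f t x i acc =
  trans (⟦searchStep⟧ acc _ i) (cong (λ v → searchStep acc (⟦ f ⟧ (t ∷ i ∷ v)) i) (⟦lastVars⟧ 3 (i ∷ acc ∷ t ∷ x)))

mutual
  `run : ∀ {n} → PR n → Expr (suc n)
  `run zeroF       = `suc `zero
  `run succF       = `suc (`suc v₁)
  `run (proj i)    = `suc (`var (Fin.suc i))
  `run (comp f gs) = `app `and (`allHalted (`run* gs) ∷ `app (`run f) (v₀ ∷ `pred* (`run* gs)) ∷ [])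
  `run (prec f g)  = `rec v₁ (`app (`run f) (v₀ ∷ lastVars 2)) (precStep (`run g))
  `run (mu f)      = `app `pred (`rec v₀ (`suc `zero) (searchStepWith (`run f)) ∷ [])

  `run* : ∀ {n m} → Vec (PR n) m → Vec (Expr (suc n)) m
  `run* []       = []
  `run* (g ∷ gs) = `run g ∷ `run* gs

mutual
  ⟦run⟧ : ∀ {n} (f : PR n) t x → ⟦ `run f ⟧ (t ∷ x) ≡ run t f x
  ⟦run⟧ zeroF       t x        = refl
  ⟦run⟧ succF       t (k ∷ []) = refl
  ⟦run⟧ (proj i)    t x        = refl
  ⟦run⟧ (comp f gs) t x        = begin
    ⟦ `app `and (`allHalted (`run* gs) ∷ `app (`run f) (v₀ ∷ `pred* (`run* gs)) ∷ []) ⟧ (t ∷ x)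
      ≡⟨ ⟦and⟧ (⟦ `allHalted (`run* gs) ⟧ (t ∷ x)) _ ⟩
    and (⟦ `allHalted (`run* gs) ⟧ (t ∷ x)) (⟦ `run f ⟧ (t ∷ ⟦ `pred* (`run* gs) ⟧* (t ∷ x)))
      ≡⟨ cong₂ and (⟦allHalted⟧ (`run* gs) (t ∷ x)) (cong (λ v → ⟦ `run f ⟧ (t ∷ v)) (⟦pred*⟧ (`run* gs) (t ∷ x))) ⟩
    and (allHalted (⟦ `run* gs ⟧* (t ∷ x))) (⟦ `run f ⟧ (t ∷ map pred (⟦ `run* gs ⟧* (t ∷ x))))
      ≡⟨ cong (λ v → and (allHalted v) (⟦ `run f ⟧ (t ∷ map pred v))) (⟦run*⟧ gs t x) ⟩
    and (allHalted (run* t gs x)) (⟦ `run f ⟧ (t ∷ map pred (run* t gs x)))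
      ≡⟨ cong (and (allHalted (run* t gs x))) (⟦run⟧ f t _) ⟩
    run t (comp f gs) x ∎
    where open ≡-Reasoning
  ⟦run⟧ (prec f g)  t (k ∷ x)  = ⟦runPrec⟧ f g t k x k
  ⟦run⟧ (mu f)      t x        =
    trans (⟦pred⟧ (⟦rec⟧ (`suc `zero) (searchStepWith (`run f)) (t ∷ x) t)) (cong pred (⟦runSearch⟧ f t x t))

  ⟦run*⟧ : ∀ {n m} (gs : Vec (PR n) m) t x → ⟦ `run* gs ⟧* (t ∷ x) ≡ run* t gs x
  ⟦run*⟧ []       t x = refl
  ⟦run*⟧ (g ∷ gs) t x = cong₂ _∷_ (⟦run⟧ g t x) (⟦run*⟧ gs t x)

  ⟦runPrec⟧ : ∀ {n} (f : PR n) g t k₀ x k →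
              ⟦rec⟧ (`app (`run f) (v₀ ∷ lastVars 2)) (precStep (`run g)) (t ∷ k₀ ∷ x) k ≡ runPrec t f g k x
  ⟦runPrec⟧ f g t k₀ x zero    = trans (cong (λ v → ⟦ `run f ⟧ (t ∷ v)) (⟦lastVars⟧ 2 (t ∷ k₀ ∷ x))) (⟦run⟧ f t x)
  ⟦runPrec⟧ f g t k₀ x (suc k) =
    trans (⟦precStep⟧ (`run g) t k₀ x k _)
          (trans (cong (λ a → and a (⟦ `run g ⟧ (t ∷ k ∷ pred a ∷ x))) (⟦runPrec⟧ f g t k₀ x k))
                 (cong (and (runPrec t f g k x)) (⟦run⟧ g t _)))

  ⟦runSearch⟧ : ∀ {n} (f : PR (suc n)) t x i →
                ⟦rec⟧ (`suc `zero) (searchStepWith (`run f)) (t ∷ x) i ≡ runSearch t f x i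
  ⟦runSearch⟧ f t x zero    = refl
  ⟦runSearch⟧ f t x (suc i) =
    trans (⟦searchStepWith⟧ (`run f) t x i _) (cong₂ (λ a b → searchStep a b i) (⟦runSearch⟧ f t x i) (⟦run⟧ f t _))

listable⇒semidec : ∀ {k} {A : Vec ℕ k → Set} → Listable A → SemiDecidable A
listable⇒semidec {k} {A} (f , A⇔halts) = record
  { test = `run f ; test-mono = λ {w} {w'} → mono {w} {w'} ; test-sound = λ {w} → sound {w} ; test-complete = complete }
  where
  mono : ∀ {w w'} x → w ≤ w' → 0 < ⟦ `run f ⟧ (w ∷ x) → 0 < ⟦ `run f ⟧ (w' ∷ x)
  mono {w} {w'} x w≤w' p =
    subst (0 <_) (sym (trans (⟦run⟧ f w' x) (run-mono f x w≤w' (trans (sym (⟦run⟧ f w x)) (positive⇒suc p)))))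
          (s≤s z≤n)
  sound : ∀ {w} x → 0 < ⟦ `run f ⟧ (w ∷ x) → A x
  sound {w} x p = Equivalence.from (A⇔halts x) (_ , run-sound w f x (trans (sym (⟦run⟧ f w x)) (positive⇒suc p)))
  complete : ∀ x → A x → ∃ λ w → 0 < ⟦ `run f ⟧ (w ∷ x)
  complete x a with Equivalence.to (A⇔halts x) a
  ... | y , d with run-complete d
  ...   | t , e = t , subst (0 <_) (sym (trans (⟦run⟧ f t x) e)) (s≤s z≤n)

⟦++⟧ : ∀ {n m k} (es : Vec (Expr n) m) (ds : Vec (Expr n) k) x → ⟦ es ++ ds ⟧* x ≡ ⟦ es ⟧* x ++ ⟦ ds ⟧* x
⟦++⟧ []       ds x = refl
⟦++⟧ (e ∷ es) ds x = cong (⟦ e ⟧ x ∷_) (⟦++⟧ es ds x)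

⟦∷ʳ⟧ : ∀ {n m} (es : Vec (Expr n) m) e x → ⟦ es ∷ʳ e ⟧* x ≡ ⟦ es ⟧* x ∷ʳ ⟦ e ⟧ x
⟦∷ʳ⟧ []        e x = refl
⟦∷ʳ⟧ (e′ ∷ es) e x = cong (⟦ e′ ⟧ x ∷_) (⟦∷ʳ⟧ es e x)

-- Pulling a positive existential definition back along a listable presentation ρ gives a
-- semidecidable relation on codes: the values of subterms are guessed as codes, which is
-- possible since ρ is onto.
module Presented {L : Language} (𝔔 : ℚStructure L) {ρ : ℕ → ℚ} (ρ-pres : IsListablePresentation 𝔔 ρ) where

  surjective : Surjective ρ
  surjective = proj₁ ρ-pres

  surjective* : ∀ {k} (qs : Vec ℚ k) → ∃ λ ms → map ρ ms ≡ qs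
  surjective* []       = [] , refl
  surjective* (q ∷ qs) with surjective q | surjective* qs
  ... | m , ρm≡q | ms , ρms≡qs = m ∷ ms , cong₂ _∷_ ρm≡q ρms≡qs

  ≡-semidec : SemiDecidable (λ v → ρ (lookup v Fin.zero) ≡ ρ (lookup v (Fin.suc Fin.zero)))
  ≡-semidec = listable⇒semidec (proj₁ (proj₂ ρ-pres))

  Evaluates : ∀ {n} → Term L n → Vec ℕ (suc n) → Set
  Evaluates t (m ∷ x) = evalT 𝔔 (map ρ x) t ≡ ρ m

  EvaluatesAll : ∀ {n k} → Vec (Term L n) k → Vec ℕ (k + n) → Set
  EvaluatesAll {k = k} ts v = evalTs 𝔔 (map ρ (drop k v)) ts ≡ map ρ (take k v)

  mutual
    term-semidec : ∀ {n} (t : Term L n) → SemiDecidable (Evaluates t)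
    term-semidec (var i) =
      semidec-resp (λ { (m ∷ x) e → trans (lookup-map i ρ x) e })
                   (λ { (m ∷ x) e → trans (sym (lookup-map i ρ x)) e })
        (semidec-∘ ≡-semidec (`var (Fin.suc i) ∷ v₀ ∷ [])
                   (λ { (m ∷ x) → lookup x i ∷ m ∷ [] }) (λ { (m ∷ x) → refl }))
    term-semidec {n} (app f ts) = semidec-resp sound complete (∃ⁿ-semidec k (∧-semidec args graph))
      where
      k : ℕ
      k = funArity L f
      ArgsEvaluate GraphHolds : Vec ℕ (k + suc n) → Set
      ArgsEvaluate v = evalTs 𝔔 (map ρ (tail (drop k v))) ts ≡ map ρ (take k v)
      GraphHolds   v = funI 𝔔 f (map ρ (take k v)) ≡ ρ (head (drop k v))
      args : SemiDecidable ArgsEvaluate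
      args = semidec-cong (λ (a , b) → evalTs 𝔔 (map ρ a) ts ≡ map ρ b)
               (λ v → cong₂ _,_ (drop-++ (take k v) _) (take-++ (take k v) _))
               (semidec-∘ (terms-semidec ts) (firstVars k ++ tail (lastVars k)) (λ v → take k v ++ tail (drop k v))
                  (λ v → trans (⟦++⟧ (firstVars k) _ v) (cong₂ _++_ (⟦firstVars⟧ k v) (cong tail (⟦lastVars⟧ k v)))))
      graph : SemiDecidable GraphHolds
      graph = semidec-cong (λ (a , b) → funI 𝔔 f (map ρ a) ≡ ρ b)
                (λ v → cong₂ _,_ (init-∷ʳ _ (take k v)) (last-∷ʳ _ (take k v)))
                (semidec-∘ (listable⇒semidec (proj₂ (proj₂ (proj₂ ρ-pres)) f))
                   (firstVars k ∷ʳ `var (k ↑ʳ Fin.zero)) (λ v → take k v ∷ʳ head (drop k v))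
                   (λ v → trans (⟦∷ʳ⟧ (firstVars k) _ v)
                                (cong₂ _∷ʳ_ (⟦firstVars⟧ k v) (cong head (⟦lastVars⟧ k v)))))
      sound : ∀ v → (∃ λ ms → ArgsEvaluate (ms ++ v) × GraphHolds (ms ++ v)) → Evaluates (app f ts) v
      sound (m ∷ x) (ms , args≡ , graph≡)
        rewrite take-++ ms (m ∷ x) | drop-++ ms (m ∷ x) = trans (cong (funI 𝔔 f) args≡) graph≡
      complete : ∀ v → Evaluates (app f ts) v → ∃ λ ms → ArgsEvaluate (ms ++ v) × GraphHolds (ms ++ v)
      complete (m ∷ x) e with surjective* (evalTs 𝔔 (map ρ x) ts)
      ... | ms , ρms≡ = ms , witness ms m x (sym ρms≡) (trans (cong (funI 𝔔 f) ρms≡) e)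
        where
        witness : ∀ ms m x → evalTs 𝔔 (map ρ x) ts ≡ map ρ ms → funI 𝔔 f (map ρ ms) ≡ ρ m →
                  ArgsEvaluate (ms ++ m ∷ x) × GraphHolds (ms ++ m ∷ x)
        witness ms m x args≡ graph≡ rewrite take-++ ms (m ∷ x) | drop-++ ms (m ∷ x) = args≡ , graph≡

    terms-semidec : ∀ {n k} (ts : Vec (Term L n) k) → SemiDecidable (EvaluatesAll ts)
    terms-semidec []                   = semidec-⊤ (λ v → refl)
    terms-semidec {n} {suc k} (t ∷ ts) =
      semidec-resp (λ { (a ∷ v) (e₁ , e₂) → cong₂ _∷_ e₁ e₂ }) (λ { (a ∷ v) e → ∷-injectiveˡ e , ∷-injectiveʳ e })
        (∧-semidec (semidec-∘ (term-semidec t) (v₀ ∷ lastVars (suc k)) (λ v → head v ∷ drop (suc k) v)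
                              (λ { (a ∷ v) → cong (a ∷_) (⟦lastVars⟧ (suc k) (a ∷ v)) }))
                   (semidec-∘ (terms-semidec ts) (lastVars 1) tail (λ { (a ∷ v) → ⟦lastVars⟧ 1 (a ∷ v) })))

  formula-semidec : ∀ {n} (φ : PEFormula L n) → SemiDecidable (λ x → Sat 𝔔 φ (map ρ x))
  formula-semidec (s ≐ t) =
    semidec-resp (λ x (m , s≡ρm , t≡ρm) → trans s≡ρm (sym t≡ρm))
                 (λ x s≡t → let (m , ρm≡s) = surjective (evalT 𝔔 (map ρ x) s) in
                            m , sym ρm≡s , trans (sym s≡t) (sym ρm≡s))
                 (∃-semidec (∧-semidec (term-semidec s) (term-semidec t)))
  formula-semidec {n} (rel r ts) = semidec-resp sound complete (∃ⁿ-semidec k (∧-semidec (terms-semidec ts) holds))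
    where
    k : ℕ
    k = relArity L r
    Holds : Vec ℕ (k + n) → Set
    Holds v = relI 𝔔 r (map ρ (take k v))
    holds : SemiDecidable Holds
    holds = semidec-∘ (listable⇒semidec (proj₁ (proj₂ (proj₂ ρ-pres)) r)) (firstVars k) (take k) (⟦firstVars⟧ k)
    sound : ∀ x → (∃ λ ms → EvaluatesAll ts (ms ++ x) × Holds (ms ++ x)) → relI 𝔔 r (evalTs 𝔔 (map ρ x) ts)
    sound x (ms , args≡ , r-holds) rewrite take-++ ms x | drop-++ ms x = subst (relI 𝔔 r) (sym args≡) r-holds
    complete : ∀ x → relI 𝔔 r (evalTs 𝔔 (map ρ x) ts) → ∃ λ ms → EvaluatesAll ts (ms ++ x) × Holds (ms ++ x)
    complete x r-holds with surjective* (evalTs 𝔔 (map ρ x) ts)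
    ... | ms , ρms≡ = ms , witness ms x (sym ρms≡) (subst (relI 𝔔 r) (sym ρms≡) r-holds)
      where
      witness : ∀ ms x → evalTs 𝔔 (map ρ x) ts ≡ map ρ ms → relI 𝔔 r (map ρ ms) →
                EvaluatesAll ts (ms ++ x) × Holds (ms ++ x)
      witness ms x args≡ r-holds rewrite take-++ ms x | drop-++ ms x = args≡ , r-holds
  formula-semidec (φ ∧ ψ) = ∧-semidec (formula-semidec φ) (formula-semidec ψ)
  formula-semidec (φ ∨ ψ) = ∨-semidec (formula-semidec φ) (formula-semidec ψ)
  formula-semidec (∃' φ)  =
    semidec-resp (λ x (y , sat) → ρ y , sat)
                 (λ x (a , sat) → let (y , ρy≡a) = surjective a in
                                  y , subst (λ b → Sat 𝔔 φ (b ∷ map ρ x)) (sym ρy≡a) sat)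
                 (∃-semidec (formula-semidec φ))

  definable-semidec : ∀ {k} {X : Vec ℚ k → Set} → PEDefinable 𝔔 X → SemiDecidable (λ x → X (map ρ x))
  definable-semidec (φ , φ⇔X) =
    semidec-resp (λ x → Equivalence.to (φ⇔X (map ρ x))) (λ x → Equivalence.from (φ⇔X (map ρ x))) (formula-semidec φ)

-- The enumeration τ

τ-aux-suc : ∀ k n → n < k → τ-aux k n ≡ τ-aux (suc k) n
τ-aux-suc (suc k) zero                     _         = refl
τ-aux-suc (suc k) (suc zero)               _         = refl
τ-aux-suc (suc k) (suc (suc zero))         _         = refl
τ-aux-suc (suc k) n@(suc (suc (suc m)))    (s≤s n≤k) = step (n % 4)
  where
  IH : ∀ i → i < n → τ-aux k i ≡ τ-aux (suc k) i
  IH i i<n = τ-aux-suc k i (≤-trans i<n n≤k)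
  step : ∀ r → τ-step k n r ≡ τ-step (suc k) n r
  step 0 = cong (ℚ._- 1ℚ) (IH (n / 2) (m/n<m n 2 (s≤s (s≤s z≤n))))
  step 3 = cong (ℚ._+ 1ℚ) (IH ((n ∸ 1) / 2) (s≤s (m/n≤m (suc (suc m)) 2)))
  step 1 = cong inv (IH (n ∸ 2) (s≤s (n≤1+n (suc m))))
  step 2 = cong inv (IH (n ∸ 2) (s≤s (n≤1+n (suc m))))
  step (suc (suc (suc (suc r)))) = cong inv (IH (n ∸ 2) (s≤s (n≤1+n (suc m))))

τ-aux-fuel : ∀ k n → n < k → τ-aux k n ≡ τ n
τ-aux-fuel k n n<k = subst (λ j → τ-aux j n ≡ τ n) (m∸n+n≡m n<k) (extra (k ∸ suc n))
  where
  extra : ∀ d → τ-aux (d + suc n) n ≡ τ n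
  extra zero    = refl
  extra (suc d) = trans (sym (τ-aux-suc (d + suc n) n (m≤n+m (suc n) d))) (extra d)

*2-distrib : ∀ m j → (m + j * 2) * 2 ≡ m * 2 + j * 4
*2-distrib m j = trans (*-distribʳ-+ 2 m (j * 2)) (cong (_+_ (m * 2)) (*-assoc j 2 2))

k*2≤1+k*4 : ∀ k → k * 2 ≤ suc (k * 4)
k*2≤1+k*4 k = ≤-trans (*-monoʳ-≤ k (s≤s (s≤s z≤n))) (n≤1+n _)

τ-4k+3 : ∀ k → τ (3 + k * 4) ≡ τ (1 + k * 2) ℚ.+ 1ℚ
τ-4k+3 k = begin
  τ-step n n (n % 4)                       ≡⟨ cong (τ-step n n) ([m+kn]%n≡m%n 3 k 4) ⟩
  τ-aux n ((2 + k * 4) / 2) ℚ.+ 1ℚ          ≡⟨ cong (λ m → τ-aux n (m / 2) ℚ.+ 1ℚ) (sym (*2-distrib 1 k)) ⟩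
  τ-aux n ((1 + k * 2) * 2 / 2) ℚ.+ 1ℚ      ≡⟨ cong (λ m → τ-aux n m ℚ.+ 1ℚ) (m*n/n≡m (1 + k * 2) 2) ⟩
  τ-aux n (1 + k * 2) ℚ.+ 1ℚ                ≡⟨ cong (ℚ._+ 1ℚ) (τ-aux-fuel n _ (s≤s (s≤s (k*2≤1+k*4 k)))) ⟩
  τ (1 + k * 2) ℚ.+ 1ℚ                      ∎
  where
  open ≡-Reasoning
  n : ℕ
  n = 3 + k * 4

τ-4k+4 : ∀ k → τ (4 + k * 4) ≡ τ (2 + k * 2) ℚ.- 1ℚ
τ-4k+4 k = begin
  τ-step n n (n % 4)                       ≡⟨ cong (τ-step n n) ([m+kn]%n≡m%n 0 (suc k) 4) ⟩
  τ-aux n ((4 + k * 4) / 2) ℚ.- 1ℚ          ≡⟨ cong (λ m → τ-aux n (m / 2) ℚ.- 1ℚ) (sym (*2-distrib 2 k)) ⟩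
  τ-aux n ((2 + k * 2) * 2 / 2) ℚ.- 1ℚ      ≡⟨ cong (λ m → τ-aux n m ℚ.- 1ℚ) (m*n/n≡m (2 + k * 2) 2) ⟩
  τ-aux n (2 + k * 2) ℚ.- 1ℚ                ≡⟨ cong (ℚ._- 1ℚ) (τ-aux-fuel n _ (s≤s (s≤s (s≤s (k*2≤1+k*4 k))))) ⟩
  τ (2 + k * 2) ℚ.- 1ℚ                      ∎
  where
  open ≡-Reasoning
  n : ℕ
  n = 4 + k * 4

τ-4k+5 : ∀ k → τ (5 + k * 4) ≡ inv (τ (3 + k * 4))
τ-4k+5 k = trans (cong (τ-step n n) ([m+kn]%n≡m%n 1 (suc k) 4)) (cong inv (τ-aux-fuel n _ (n≤1+n _)))
  where
  n : ℕ
  n = 5 + k * 4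

τ-4k+6 : ∀ k → τ (6 + k * 4) ≡ inv (τ (4 + k * 4))
τ-4k+6 k = trans (cong (τ-step n n) ([m+kn]%n≡m%n 2 (suc k) 4)) (cong inv (τ-aux-fuel n _ (n≤1+n _)))
  where
  n : ℕ
  n = 6 + k * 4

mkℚ-zero : ∀ d .(c : Coprime 0 (suc d)) → mkℚ (+ 0) d c ≡ 0ℚ
mkℚ-zero d c with Coprimality.recompute c ((suc d ∣0) , ∣-refl)
... | refl = refl

inv-neg : ∀ x → inv (- x) ≡ - inv x
inv-neg (mkℚ (+ zero)  d c) = subst (λ x → inv (- x) ≡ - inv x) (sym (mkℚ-zero d c)) refl
inv-neg (mkℚ (+ suc n) d c) = refl
inv-neg (mkℚ -[1+ n ]  d c) = refl

parity : ∀ k → k ≡ 0 ⊎ (∃ λ j → k ≡ 1 + j * 2) ⊎ (∃ λ j → k ≡ 2 + j * 2)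
parity zero = inj₁ refl
parity (suc k) with parity k
... | inj₁ refl              = inj₂ (inj₁ (0 , refl))
... | inj₂ (inj₁ (j , refl)) = inj₂ (inj₂ (j , refl))
... | inj₂ (inj₂ (j , refl)) = inj₂ (inj₁ (suc j , refl))

-- Negation swaps x + 1 with x - 1 and commutes with 1/x, so even indices mirror odd ones.
τ-even : ∀ k → τ (2 + k * 2) ≡ - τ (1 + k * 2)
τ-even = <-rec (λ k → τ (2 + k * 2) ≡ - τ (1 + k * 2)) step
  where
  open ≡-Reasoning
  step : ∀ k → (∀ {j} → j < k → τ (2 + j * 2) ≡ - τ (1 + j * 2)) → τ (2 + k * 2) ≡ - τ (1 + k * 2)
  step k IH with parity k
  ... | inj₁ refl = refl
  ... | inj₂ (inj₁ (j , refl)) = begin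
    τ (2 + (1 + j * 2) * 2)           ≡⟨ cong (λ m → τ (2 + m)) (*2-distrib 1 j) ⟩
    τ (4 + j * 4)                     ≡⟨ τ-4k+4 j ⟩
    τ (2 + j * 2) ℚ.- 1ℚ              ≡⟨ cong (ℚ._- 1ℚ) (IH (s≤s (m≤m*n j 2))) ⟩
    (- τ (1 + j * 2)) ℚ.+ (- 1ℚ)      ≡⟨ sym (neg-distrib-+ (τ (1 + j * 2)) 1ℚ) ⟩
    - (τ (1 + j * 2) ℚ.+ 1ℚ)          ≡⟨ cong -_ (sym (τ-4k+3 j)) ⟩
    - τ (3 + j * 4)                   ≡⟨ cong (λ m → - τ (1 + m)) (sym (*2-distrib 1 j)) ⟩
    - τ (1 + (1 + j * 2) * 2)         ∎
  ... | inj₂ (inj₂ (j , refl)) = begin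
    τ (2 + (2 + j * 2) * 2)           ≡⟨ cong (λ m → τ (2 + m)) (*2-distrib 2 j) ⟩
    τ (6 + j * 4)                     ≡⟨ τ-4k+6 j ⟩
    inv (τ (4 + j * 4))               ≡⟨ cong (λ m → inv (τ (2 + m))) (sym (*2-distrib 1 j)) ⟩
    inv (τ (2 + (1 + j * 2) * 2))     ≡⟨ cong inv (IH ≤-refl) ⟩
    inv (- τ (1 + (1 + j * 2) * 2))   ≡⟨ inv-neg (τ (1 + (1 + j * 2) * 2)) ⟩
    - inv (τ (1 + (1 + j * 2) * 2))   ≡⟨ cong (λ m → - inv (τ (1 + m))) (*2-distrib 1 j) ⟩
    - inv (τ (3 + j * 4))             ≡⟨ cong -_ (sym (τ-4k+5 j)) ⟩
    - τ (5 + j * 4)                   ≡⟨ cong (λ m → - τ (1 + m)) (sym (*2-distrib 2 j)) ⟩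
    - τ (1 + (2 + j * 2) * 2)         ∎

mkℚ-cong : ∀ {a b d} .{c : Coprime a (suc d)} .{c′ : Coprime b (suc d)} → a ≡ b → mkℚ (+ a) d c ≡ mkℚ (+ b) d c′
mkℚ-cong refl = refl

mkℚ-+1 : ∀ n d .(c : Coprime (suc n) (suc d)) (c′ : Coprime (suc n + suc d) (suc d)) →
         mkℚ (+ suc n) d c ℚ.+ 1ℚ ≡ mkℚ (+ (suc n + suc d)) d c′
mkℚ-+1 n d c c′ =
  trans (normalize-cong (cong₂ _+_ (*-identityʳ (suc n)) (*-identityˡ (suc d))) (*-identityʳ (suc d)))
        (normalize-coprime c′)

coprime-+⁻¹ : ∀ {m n} → Coprime (m + n) n → Coprime m n
coprime-+⁻¹ c (i∣m , i∣n) = c (∣m∣n⇒∣m+n i∣m i∣n , i∣n)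

euclid-step : ∀ {n d s} → d < n → n + d ≤ suc s → suc (n ∸ suc d) + suc d ≡ suc n × n ∸ suc d + d ≤ s
euclid-step {n} {d} {s} d<n n+d≤1+s = e+d+1≡n , ≤-pred (begin
  suc (n ∸ suc d + d) ≡⟨ +-suc (n ∸ suc d) d ⟨
  n ∸ suc d + suc d   ≡⟨ m∸n+n≡m d<n ⟩
  n                   ≤⟨ m≤m+n n d ⟩
  n + d               ≤⟨ n+d≤1+s ⟩
  suc s               ∎)
  where
  open ≤-Reasoning
  e+d+1≡n : suc (n ∸ suc d) + suc d ≡ suc n
  e+d+1≡n = cong suc (m∸n+n≡m d<n)

τ-descend-+1 : ∀ k → τ (1 + (1 + k * 2) * 2) ≡ τ (1 + k * 2) ℚ.+ 1ℚ
τ-descend-+1 k = trans (cong (λ m → τ (1 + m)) (*2-distrib 1 k)) (τ-4k+3 k)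

τ-descend-inv : ∀ k → τ (1 + (2 + k * 2) * 2) ≡ inv (τ (1 + k * 2) ℚ.+ 1ℚ)
τ-descend-inv k = trans (cong (λ m → τ (1 + m)) (*2-distrib 2 k)) (trans (τ-4k+5 k) (cong inv (τ-4k+3 k)))

-- Subtracting the smaller of numerator and denominator from the larger (the Calkin–Wilf descent)
-- is undone by τ(4k+3) = τ(2k+1) + 1 and τ(4k+5) = 1/τ(4k+3).
τ-odd-positive : ∀ s n d → n + d ≤ s → (c : Coprime (suc n) (suc d)) → ∃ λ k → τ (1 + k * 2) ≡ mkℚ (+ suc n) d c
τ-odd-positive zero zero zero z≤n c = 0 , refl
τ-odd-positive (suc s) n d n+d≤1+s c with <-cmp n d
... | tri≈ _ refl _ with c {suc n} (∣-refl , ∣-refl)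
...   | refl = 0 , refl
τ-odd-positive (suc s) n d n+d≤1+s c | tri> _ _ d<n = 1 + k * 2 , (begin
  τ (1 + (1 + k * 2) * 2)                          ≡⟨ τ-descend-+1 k ⟩
  τ (1 + k * 2) ℚ.+ 1ℚ                             ≡⟨ cong (ℚ._+ 1ℚ) (proj₂ IH) ⟩
  mkℚ (+ suc e) d (coprime-+⁻¹ c′) ℚ.+ 1ℚ          ≡⟨ mkℚ-+1 e d (coprime-+⁻¹ c′) c′ ⟩
  mkℚ (+ (suc e + suc d)) d c′                     ≡⟨ mkℚ-cong (proj₁ step) ⟩
  mkℚ (+ suc n) d c                                ∎)
  where
  open ≡-Reasoning
  e : ℕ
  e = n ∸ suc d
  step : suc e + suc d ≡ suc n × e + d ≤ s
  step = euclid-step d<n n+d≤1+s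
  c′ : Coprime (suc e + suc d) (suc d)
  c′ = subst (λ v → Coprime v (suc d)) (sym (proj₁ step)) c
  IH : ∃ λ k → τ (1 + k * 2) ≡ mkℚ (+ suc e) d (coprime-+⁻¹ c′)
  IH = τ-odd-positive s e d (proj₂ step) (coprime-+⁻¹ c′)
  k : ℕ
  k = proj₁ IH
τ-odd-positive (suc s) n d n+d≤1+s c | tri< n<d _ _ = 2 + k * 2 , (begin
  τ (1 + (2 + k * 2) * 2)                          ≡⟨ τ-descend-inv k ⟩
  inv (τ (1 + k * 2) ℚ.+ 1ℚ)                       ≡⟨ cong (λ q → inv (q ℚ.+ 1ℚ)) (proj₂ IH) ⟩
  inv (mkℚ (+ suc e) n (coprime-+⁻¹ c′) ℚ.+ 1ℚ)    ≡⟨ cong inv (mkℚ-+1 e n (coprime-+⁻¹ c′) c′) ⟩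
  inv (mkℚ (+ (suc e + suc n)) n c′)
    ≡⟨ cong inv (mkℚ-cong {c = c′} {c′ = Coprimality.sym c} (proj₁ step)) ⟩
  mkℚ (+ suc n) d c                                ∎)
  where
  open ≡-Reasoning
  e : ℕ
  e = d ∸ suc n
  step : suc e + suc n ≡ suc d × e + n ≤ s
  step = euclid-step n<d (subst (_≤ suc s) (+-comm n d) n+d≤1+s)
  c′ : Coprime (suc e + suc n) (suc n)
  c′ = subst (λ v → Coprime v (suc n)) (sym (proj₁ step)) (Coprimality.sym c)
  IH : ∃ λ k → τ (1 + k * 2) ≡ mkℚ (+ suc e) n (coprime-+⁻¹ c′)
  IH = τ-odd-positive s e n (proj₂ step) (coprime-+⁻¹ c′)
  k : ℕ
  k = proj₁ IH

τ-surjective : Surjective τ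
τ-surjective (mkℚ (+ zero) d c) = 0 , sym (mkℚ-zero d c)
τ-surjective (mkℚ (+ suc n) d c) with τ-odd-positive (n + d) n d ≤-refl (Coprimality.recompute c)
... | k , τ≡q = 1 + k * 2 , τ≡q
τ-surjective (mkℚ -[1+ n ] d c) with τ-odd-positive (n + d) n d ≤-refl (Coprimality.recompute c)
... | k , τ≡q = 2 + k * 2 , trans (τ-even k) (cong -_ τ≡q)

-- Remainder and quotient by 4, defined by primitive recursion so that they are easy to program.
cycle4 : ℕ → ℕ
cycle4 0 = 1
cycle4 1 = 2
cycle4 2 = 3
cycle4 (suc (suc (suc _))) = 0

carry4 : ℕ → ℕ → ℕ
carry4 0 q = q
carry4 1 q = q
carry4 2 q = q
carry4 (suc (suc (suc _))) q = suc q

mod4 : ℕ → ℕ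
mod4 zero    = 0
mod4 (suc i) = cycle4 (mod4 i)

div4 : ℕ → ℕ
div4 zero    = 0
div4 (suc i) = carry4 (mod4 i) (div4 i)

mod4-div4 : ∀ d → d ≡ mod4 d + div4 d * 4 × mod4 d < 4
mod4-div4 zero = refl , s≤s z≤n
mod4-div4 (suc d) with mod4 d | div4 d | mod4-div4 d
... | 0 | q | d≡ , _ = cong suc d≡ , s≤s (s≤s z≤n)
... | 1 | q | d≡ , _ = cong suc d≡ , s≤s (s≤s (s≤s z≤n))
... | 2 | q | d≡ , _ = cong suc d≡ , s≤s (s≤s (s≤s (s≤s z≤n)))
... | 3 | q | d≡ , _ = cong suc d≡ , s≤s z≤n
... | suc (suc (suc (suc r))) | q | _ , s≤s (s≤s (s≤s (s≤s ())))

double : ℕ → ℕ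
double zero    = 0
double (suc k) = suc (suc (double k))

double≡*2 : ∀ k → double k ≡ k * 2
double≡*2 zero    = refl
double≡*2 (suc k) = cong (λ v → suc (suc v)) (double≡*2 k)

double≤*4 : ∀ k → double k ≤ k * 4
double≤*4 zero    = z≤n
double≤*4 (suc k) = s≤s (s≤s (≤-trans (double≤*4 k) (m≤n+m (k * 4) 2)))

-- The index from which τ (3 + d) is computed, where d = 4q + r.
parentOf : ℕ → ℕ → ℕ → ℕ
parentOf d 0 q = suc (double q)
parentOf d 1 q = suc (suc (double q))
parentOf d (suc (suc _)) q = suc d

parent : ℕ → ℕ
parent 0 = 0
parent 1 = 1
parent 2 = 2
parent (suc (suc (suc d))) = parentOf d (mod4 d) (div4 d)

parentOp : ℕ → ℚ → ℚ
parentOp 0             q = q ℚ.+ 1ℚ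
parentOp 1             q = q ℚ.- 1ℚ
parentOp (suc (suc _)) q = inv q

τ-parent : ∀ d → τ (3 + d) ≡ parentOp (mod4 d) (τ (parent (3 + d)))
τ-parent d with mod4 d | div4 d | mod4-div4 d
... | 0 | q | refl , _ = trans (τ-4k+3 q) (cong (λ v → τ (suc v) ℚ.+ 1ℚ) (sym (double≡*2 q)))
... | 1 | q | refl , _ = trans (τ-4k+4 q) (cong (λ v → τ (suc (suc v)) ℚ.- 1ℚ) (sym (double≡*2 q)))
... | 2 | q | refl , _ = τ-4k+5 q
... | 3 | q | refl , _ = τ-4k+6 q
... | suc (suc (suc (suc r))) | q | _ , s≤s (s≤s (s≤s (s≤s ())))

parent≡ : ∀ c → c ≤ 2 → parent c ≡ c
parent≡ 0 _ = refl
parent≡ 1 _ = refl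
parent≡ 2 _ = refl
parent≡ (suc (suc (suc c))) (s≤s (s≤s ()))

parent< : ∀ d → parent (3 + d) < 3 + d
parent< d with mod4 d | div4 d | mod4-div4 d
... | 0 | q | refl , _ = s≤s (s≤s (≤-trans (double≤*4 q) (n≤1+n _)))
... | 1 | q | refl , _ = s≤s (s≤s (s≤s (≤-trans (double≤*4 q) (n≤1+n _))))
... | suc (suc r) | q | _ = s≤s (n≤1+n _)

ancestor : ℕ → ℕ → ℕ
ancestor zero    n = n
ancestor (suc i) n = parent (ancestor i n)

ancestor-descends : ∀ i n → ancestor i n ≤ 2 ⊎ ancestor i n + i ≤ n
ancestor-descends zero    n = inj₂ (≤-reflexive (+-identityʳ n))
ancestor-descends (suc i) n with ancestor-descends i n
... | inj₁ a≤2 = inj₁ (subst (_≤ 2) (sym (parent≡ _ a≤2)) a≤2)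
... | inj₂ a+i≤n with ancestor i n | a+i≤n
...   | 0 | _ = inj₁ z≤n
...   | 1 | _ = inj₁ (s≤s z≤n)
...   | 2 | _ = inj₁ (s≤s (s≤s z≤n))
...   | suc (suc (suc d)) | a+i≤n′ =
  inj₂ (≤-trans (≤-reflexive (+-suc (parent (3 + d)) i)) (≤-trans (+-monoˡ-≤ i (parent< d)) a+i≤n′))

ancestor-root : ∀ n → ancestor n n ≤ 2
ancestor-root n with ancestor-descends n n
... | inj₁ a≤2 = a≤2
... | inj₂ a+n≤n with ancestor n n | a+n≤n
...   | 0 | _ = z≤n
...   | suc a | a+n≤n′ = ⊥-elim (<-irrefl refl (≤-trans (s≤s (m≤n+m n a)) a+n≤n′))

-- Computing τ on codes

`cycle4 : Expr 1
`cycle4 = `case v₀ (`suc `zero) (`case v₀ (`suc (`suc `zero)) (`case v₀ (`suc (`suc (`suc `zero))) `zero))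

⟦cycle4⟧ : ∀ r → ⟦ `cycle4 ⟧ (r ∷ []) ≡ cycle4 r
⟦cycle4⟧ 0 = refl
⟦cycle4⟧ 1 = refl
⟦cycle4⟧ 2 = refl
⟦cycle4⟧ (suc (suc (suc r))) = refl

`carry4 : Expr 2
`carry4 = `case v₀ v₁ (`case v₀ v₂ (`case v₀ v₃ (`suc v₄)))

⟦carry4⟧ : ∀ r q → ⟦ `carry4 ⟧ (r ∷ q ∷ []) ≡ carry4 r q
⟦carry4⟧ 0 q = refl
⟦carry4⟧ 1 q = refl
⟦carry4⟧ 2 q = refl
⟦carry4⟧ (suc (suc (suc r))) q = refl

`mod4 : Expr 1
`mod4 = `rec v₀ `zero (`app `cycle4 (v₁ ∷ []))

⟦mod4⟧ : ∀ n → ⟦ `mod4 ⟧ (n ∷ []) ≡ mod4 n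
⟦mod4⟧ n = go n
  where
  go : ∀ i → ⟦rec⟧ `zero (`app `cycle4 (v₁ ∷ [])) (n ∷ []) i ≡ mod4 i
  go zero    = refl
  go (suc i) = trans (⟦cycle4⟧ (⟦rec⟧ `zero (`app `cycle4 (v₁ ∷ [])) (n ∷ []) i)) (cong cycle4 (go i))

`div4 : Expr 1
`div4 = `rec v₀ `zero (`app `carry4 (`app `mod4 (v₀ ∷ []) ∷ v₁ ∷ []))

⟦div4⟧ : ∀ n → ⟦ `div4 ⟧ (n ∷ []) ≡ div4 n
⟦div4⟧ n = go n
  where
  go : ∀ i → ⟦rec⟧ `zero (`app `carry4 (`app `mod4 (v₀ ∷ []) ∷ v₁ ∷ [])) (n ∷ []) i ≡ div4 i
  go zero    = refl
  go (suc i) = trans (⟦carry4⟧ (⟦ `mod4 ⟧ (i ∷ [])) _) (cong₂ carry4 (⟦mod4⟧ i) (go i))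

`double : Expr 1
`double = `rec v₀ `zero (`suc (`suc v₁))

⟦double⟧ : ∀ n → ⟦ `double ⟧ (n ∷ []) ≡ double n
⟦double⟧ n = go n
  where
  go : ∀ i → ⟦rec⟧ `zero (`suc (`suc v₁)) (n ∷ []) i ≡ double i
  go zero    = refl
  go (suc i) = cong (λ v → suc (suc v)) (go i)

`parentOf : Expr 3
`parentOf = `case v₀ (`suc (`app `double (v₁ ∷ []))) (`case v₀ (`suc (`suc (`app `double (v₂ ∷ [])))) (`suc v₄))

⟦parentOf⟧ : ∀ r q d → ⟦ `parentOf ⟧ (r ∷ q ∷ d ∷ []) ≡ parentOf d r q
⟦parentOf⟧ 0             q d = cong suc (⟦double⟧ q)
⟦parentOf⟧ 1             q d = cong (λ v → suc (suc v)) (⟦double⟧ q)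
⟦parentOf⟧ (suc (suc r)) q d = refl

`parent : Expr 1
`parent = `case v₀ `zero (`case v₀ (`suc `zero) (`case v₀ (`suc (`suc `zero))
            (`app `parentOf (`app `mod4 (v₀ ∷ []) ∷ `app `div4 (v₀ ∷ []) ∷ v₀ ∷ []))))

⟦parent⟧ : ∀ c → ⟦ `parent ⟧ (c ∷ []) ≡ parent c
⟦parent⟧ 0 = refl
⟦parent⟧ 1 = refl
⟦parent⟧ 2 = refl
⟦parent⟧ (suc (suc (suc d))) =
  trans (⟦parentOf⟧ (⟦ `mod4 ⟧ (d ∷ [])) (⟦ `div4 ⟧ (d ∷ [])) d) (cong₂ (parentOf d) (⟦mod4⟧ d) (⟦div4⟧ d))

`ancestor : Expr 2
`ancestor = `rec v₀ v₁ (`app `parent (v₁ ∷ []))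

⟦ancestor⟧ : ∀ i n → ⟦ `ancestor ⟧ (i ∷ n ∷ []) ≡ ancestor i n
⟦ancestor⟧ i n = go i
  where
  go : ∀ j → ⟦rec⟧ v₁ (`app `parent (v₁ ∷ [])) (i ∷ n ∷ []) j ≡ ancestor j n
  go zero    = refl
  go (suc j) = trans (⟦parent⟧ (⟦rec⟧ v₁ (`app `parent (v₁ ∷ [])) (i ∷ n ∷ []) j)) (cong parent (go j))

`monus : Expr 2
`monus = `rec v₁ v₀ (`app `pred (v₁ ∷ []))

⟦monus⟧ : ∀ a b → ⟦ `monus ⟧ (a ∷ b ∷ []) ≡ a ∸ b
⟦monus⟧ a b = go b
  where
  go : ∀ j → ⟦rec⟧ v₀ (`app `pred (v₁ ∷ [])) (a ∷ b ∷ []) j ≡ a ∸ j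
  go zero    = refl
  go (suc j) = trans (⟦pred⟧ (⟦rec⟧ v₀ (`app `pred (v₁ ∷ [])) (a ∷ b ∷ []) j))
                     (trans (cong pred (go j)) (pred[m∸n]≡m∸[1+n] a j))

swap : Vec ℕ 2 → Vec ℕ 2
swap (m ∷ n ∷ []) = n ∷ m ∷ []

`literal : ∀ {n} → ℕ → Expr n
`literal zero    = `zero
`literal (suc m) = `suc (`literal m)

⟦literal⟧ : ∀ {n} m (x : Vec ℕ n) → ⟦ `literal m ⟧ x ≡ m
⟦literal⟧ zero    x = refl
⟦literal⟧ (suc m) x = cong suc (⟦literal⟧ m x)

p-1+1≡p : ∀ p → (p ℚ.- 1ℚ) ℚ.+ 1ℚ ≡ p
p-1+1≡p p = trans (ℚ.+-assoc p (ℚ.- 1ℚ) 1ℚ) (trans (cong (p ℚ.+_) (ℚ.+-inverseˡ 1ℚ)) (ℚ.+-identityʳ p))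

p+1-1≡p : ∀ p → (p ℚ.+ 1ℚ) ℚ.- 1ℚ ≡ p
p+1-1≡p p = trans (ℚ.+-assoc p 1ℚ (ℚ.- 1ℚ)) (trans (cong (p ℚ.+_) (ℚ.+-inverseʳ 1ℚ)) (ℚ.+-identityʳ p))

module Decoding {L : Language} (𝔔 : ℚStructure L)
                (0-def : PEDefinable 𝔔 ZeroSet) (S-def : PEDefinable 𝔔 GraphS) (R-def : PEDefinable 𝔔 GraphR)
                {ρ : ℕ → ℚ} (ρ-pres : IsListablePresentation 𝔔 ρ) where

  open Presented 𝔔 ρ-pres

  unary-select : ∀ {A : Vec ℕ 2 → Set} → SemiDecidable A → (∀ n → ∃ λ m → A (m ∷ n ∷ [])) →
                 Σ (Recursive 1) λ F → ∀ n → A (function F (n ∷ []) ∷ n ∷ [])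
  unary-select {A} s total = proj₁ selected , λ n → proj₂ selected (n ∷ [])
    where
    selected : Σ (Recursive 1) λ F → ∀ x → A (function F x ∷ x)
    selected = select s (λ { (n ∷ []) → total n })

  zero-at : (i : Fin 2) → SemiDecidable (λ x → ρ (lookup x i) ≡ 0ℚ)
  zero-at i = semidec-∘ (definable-semidec 0-def) (`var i ∷ []) (λ x → lookup x i ∷ []) (λ x → refl)

  -- Opaque, since unfolding the searches behind these functions makes type checking blow up.
  opaque
    successor : Σ (Recursive 1) λ F → ∀ n → ρ (function F (n ∷ [])) ≡ ρ n ℚ.+ 1ℚ
    successor = unary-select (semidec-∘ (definable-semidec S-def) (v₁ ∷ v₀ ∷ []) swap (λ { (m ∷ n ∷ []) → refl }))
                             (λ n → surjective (ρ n ℚ.+ 1ℚ))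

    predecessor : Σ (Recursive 1) λ F → ∀ n → ρ (function F (n ∷ [])) ≡ ρ n ℚ.- 1ℚ
    predecessor = F , λ n → trans (sym (p+1-1≡p (ρ (function F (n ∷ []))))) (cong (ℚ._- 1ℚ) (sym (proj₂ selected n)))
      where
      total : ∀ n → ∃ λ m → ρ n ≡ ρ m ℚ.+ 1ℚ
      total n with surjective (ρ n ℚ.- 1ℚ)
      ... | m , ρm≡ = m , sym (trans (cong (ℚ._+ 1ℚ) ρm≡) (p-1+1≡p (ρ n)))
      selected : Σ (Recursive 1) λ F → ∀ n → ρ n ≡ ρ (function F (n ∷ [])) ℚ.+ 1ℚ
      selected = unary-select (definable-semidec S-def) total
      F : Recursive 1
      F = proj₁ selected

    -- inv is 0 at 0, outside the graph of R.
    inverse : Σ (Recursive 1) λ F → ∀ n → ρ (function F (n ∷ [])) ≡ inv (ρ n)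
    inverse = F , λ n → inverts (proj₂ selected n)
      where
      Inverts : ℕ → ℕ → Set
      Inverts n m = (ρ n ≡ 0ℚ × ρ m ≡ 0ℚ) ⊎ (¬ ρ n ≡ 0ℚ × ρ m ≡ inv (ρ n))
      total : ∀ n → ∃ λ m → Inverts n m
      total n with surjective (inv (ρ n))
      ... | m , ρm≡ = m , inverts⁻¹ ρm≡ (ρ n ℚ.≟ 0ℚ)
        where
        inverts⁻¹ : ∀ {m} → ρ m ≡ inv (ρ n) → Dec (ρ n ≡ 0ℚ) → Inverts n m
        inverts⁻¹ ρm≡ (yes ρn≡0) = inj₁ (ρn≡0 , trans ρm≡ (cong inv ρn≡0))
        inverts⁻¹ ρm≡ (no  ρn≢0) = inj₂ (ρn≢0 , ρm≡)
      selected : Σ (Recursive 1) λ F → ∀ n → Inverts n (function F (n ∷ []))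
      selected = unary-select (∨-semidec (∧-semidec (zero-at (Fin.suc Fin.zero)) (zero-at Fin.zero))
                                         (semidec-∘ (definable-semidec R-def) (v₁ ∷ v₀ ∷ []) swap
                                                    (λ { (m ∷ n ∷ []) → refl })))
                              total
      F : Recursive 1
      F = proj₁ selected
      inverts : ∀ {n m} → Inverts n m → ρ m ≡ inv (ρ n)
      inverts (inj₁ (ρn≡0 , ρm≡0)) = trans ρm≡0 (sym (cong inv ρn≡0))
      inverts (inj₂ (_ , ρm≡inv))  = ρm≡inv

  S P R : Recursive 1
  S = proj₁ successor
  P = proj₁ predecessor
  R = proj₁ inverse

  parentOpCode : ℕ → ℕ → ℕ
  parentOpCode 0             m = function S (m ∷ [])
  parentOpCode 1             m = function P (m ∷ [])
  parentOpCode (suc (suc _)) m = function R (m ∷ [])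

  `parentOpCode : Expr 2
  `parentOpCode = `case v₀ (`call S (v₁ ∷ [])) (`case v₀ (`call P (v₂ ∷ [])) (`call R (v₃ ∷ [])))

  ⟦parentOpCode⟧ : ∀ r m → ⟦ `parentOpCode ⟧ (r ∷ m ∷ []) ≡ parentOpCode r m
  ⟦parentOpCode⟧ 0             m = refl
  ⟦parentOpCode⟧ 1             m = refl
  ⟦parentOpCode⟧ (suc (suc r)) m = refl

  ρ-parentOpCode : ∀ r m → ρ (parentOpCode r m) ≡ parentOp r (ρ m)
  ρ-parentOpCode 0             m = proj₂ successor m
  ρ-parentOpCode 1             m = proj₂ predecessor m
  ρ-parentOpCode (suc (suc r)) m = proj₂ inverse m

  stepCode : ℕ → ℕ → ℕ
  stepCode 0                   m = m
  stepCode 1                   m = m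
  stepCode 2                   m = m
  stepCode (suc (suc (suc d))) m = parentOpCode (mod4 d) m

  `stepCode : Expr 2
  `stepCode = `case v₀ v₁ (`case v₀ v₂ (`case v₀ v₃ (`app `parentOpCode (`app `mod4 (v₀ ∷ []) ∷ v₄ ∷ []))))

  ⟦stepCode⟧ : ∀ c m → ⟦ `stepCode ⟧ (c ∷ m ∷ []) ≡ stepCode c m
  ⟦stepCode⟧ 0                   m = refl
  ⟦stepCode⟧ 1                   m = refl
  ⟦stepCode⟧ 2                   m = refl
  ⟦stepCode⟧ (suc (suc (suc d))) m =
    trans (⟦parentOpCode⟧ (⟦ `mod4 ⟧ (d ∷ [])) m) (cong (λ r → parentOpCode r m) (⟦mod4⟧ d))

  ρ-stepCode : ∀ c m → ρ m ≡ τ (parent c) → ρ (stepCode c m) ≡ τ c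
  ρ-stepCode 0                   m ρm≡ = ρm≡
  ρ-stepCode 1                   m ρm≡ = ρm≡
  ρ-stepCode 2                   m ρm≡ = ρm≡
  ρ-stepCode (suc (suc (suc d))) m ρm≡ =
    trans (ρ-parentOpCode (mod4 d) m) (trans (cong (parentOp (mod4 d)) ρm≡) (sym (τ-parent d)))

  rootCode : ℕ → ℕ
  rootCode 0                   = proj₁ (surjective (τ 0))
  rootCode 1                   = proj₁ (surjective (τ 1))
  rootCode 2                   = proj₁ (surjective (τ 2))
  rootCode (suc (suc (suc _))) = 0

  `rootCode : Expr 1
  `rootCode = `case v₀ (`literal (rootCode 0))
                (`case v₀ (`literal (rootCode 1)) (`case v₀ (`literal (rootCode 2)) `zero))

  ⟦rootCode⟧ : ∀ c → ⟦ `rootCode ⟧ (c ∷ []) ≡ rootCode c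
  ⟦rootCode⟧ 0                   = ⟦literal⟧ (rootCode 0) _
  ⟦rootCode⟧ 1                   = ⟦literal⟧ (rootCode 1) _
  ⟦rootCode⟧ 2                   = ⟦literal⟧ (rootCode 2) _
  ⟦rootCode⟧ (suc (suc (suc _))) = refl

  ρ-rootCode : ∀ c → c ≤ 2 → ρ (rootCode c) ≡ τ c
  ρ-rootCode 0 _ = proj₂ (surjective (τ 0))
  ρ-rootCode 1 _ = proj₂ (surjective (τ 1))
  ρ-rootCode 2 _ = proj₂ (surjective (τ 2))
  ρ-rootCode (suc (suc (suc _))) (s≤s (s≤s ()))

  -- Walk from the root ancestor n n ≤ 2 of n back down to ancestor 0 n = n; the accumulator
  -- after j steps (environment (j ∷ acc ∷ n ∷ [])) is a code of τ (ancestor (n ∸ j) n).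
  `τ-root : Expr 1
  `τ-root = `app `rootCode (`app `ancestor (v₀ ∷ v₀ ∷ []) ∷ [])

  `τ-step : Expr 3
  `τ-step = `app `stepCode (`app `ancestor (`app `monus (v₂ ∷ `suc v₀ ∷ []) ∷ v₂ ∷ []) ∷ v₁ ∷ [])

  ρ-τ-walk : ∀ n j → j ≤ n → ρ (⟦rec⟧ `τ-root `τ-step (n ∷ []) j) ≡ τ (ancestor (n ∸ j) n)
  ρ-τ-walk n zero    _ =
    trans (cong ρ (trans (⟦rootCode⟧ (⟦ `ancestor ⟧ (n ∷ n ∷ []))) (cong rootCode (⟦ancestor⟧ n n))))
          (ρ-rootCode (ancestor n n) (ancestor-root n))
  ρ-τ-walk n (suc j) j<n = begin
    ρ (⟦ `τ-step ⟧ (j ∷ acc ∷ n ∷ []))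
      ≡⟨ cong ρ (⟦stepCode⟧ (⟦ `ancestor ⟧ (⟦ `monus ⟧ (n ∷ suc j ∷ []) ∷ n ∷ [])) acc) ⟩
    ρ (stepCode (⟦ `ancestor ⟧ (⟦ `monus ⟧ (n ∷ suc j ∷ []) ∷ n ∷ [])) acc)
      ≡⟨ cong (λ c → ρ (stepCode c acc))
              (trans (⟦ancestor⟧ (⟦ `monus ⟧ (n ∷ suc j ∷ [])) n) (cong (λ i → ancestor i n) (⟦monus⟧ n (suc j)))) ⟩
    ρ (stepCode (ancestor (n ∸ suc j) n) acc)
      ≡⟨ ρ-stepCode (ancestor (n ∸ suc j) n) acc
           (trans (ρ-τ-walk n j (≤-trans (n≤1+n j) j<n)) (cong (λ i → τ (ancestor i n)) (+-∸-assoc 1 j<n))) ⟩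
    τ (ancestor (n ∸ suc j) n) ∎
    where
    open ≡-Reasoning
    acc : ℕ
    acc = ⟦rec⟧ `τ-root `τ-step (n ∷ []) j

  τ-code : Σ (Recursive 1) λ T → ∀ n → ρ (function T (n ∷ [])) ≡ τ n
  τ-code = toRecursive (`rec v₀ `τ-root `τ-step) ,
           λ n → trans (ρ-τ-walk n n ≤-refl) (cong (λ i → τ (ancestor i n)) (n∸n≡0 n))

  τ-equivalent : Equivalent ρ τ
  τ-equivalent = (λ n → function T (n ∷ [])) , (program T , λ n → program⇓ T (n ∷ [])) , λ n → sym (proj₂ τ-code n)
    where
    T : Recursive 1
    T = proj₁ τ-code

-- Equivalence of presentations

fromTotalRecursive : ∀ {φ} → TotalRecursive φ → Recursive 1
fromTotalRecursive {φ} (f , f⇓) =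
  record { program = f ; function = λ { (n ∷ []) → φ n } ; program⇓ = λ { (n ∷ []) → f⇓ n } }

`map : ∀ {m} → Recursive 1 → Vec (Expr m) m
`map F = tabulate (λ i → `call F (`var i ∷ []))

⟦map⟧ : ∀ {m} (F : Recursive 1) (v : Vec ℕ m) → ⟦ `map F ⟧* v ≡ map (λ n → function F (n ∷ [])) v
⟦map⟧ F v = trans (⟦tabulate⟧ _ v) (trans (tabulate-∘ _ (lookup v)) (cong (map _) (tabulate∘lookup v)))

listable-resp : ∀ {k} {A B : Vec ℕ k → Set} → (∀ x → A x ⇔ B x) → Listable A → Listable B
listable-resp A⇔B (f , A⇔halts) = f , λ x → ⇔.trans (⇔.sym (A⇔B x)) (A⇔halts x)

Equivalent-trans : ∀ {ρ γ δ} → Equivalent ρ γ → Equivalent γ δ → Equivalent ρ δ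
Equivalent-trans (φ , (f , f⇓) , γ≡ρ∘φ) (ψ , (g , g⇓) , δ≡γ∘ψ) =
  φ ∘ ψ , (comp f (g ∷ []) , λ n → ⇓comp (g⇓ n ∷ []) (f⇓ (ψ n))) , λ n → trans (δ≡γ∘ψ n) (γ≡ρ∘φ (ψ n))

-- Invert φ by searching, for each n, for a k with ρ (φ k) = ρ n.
Equivalent-sym : ∀ {ρ γ} → Listable {2} (λ v → ρ (lookup v Fin.zero) ≡ ρ (lookup v (Fin.suc Fin.zero))) →
                 Surjective γ → Equivalent ρ γ → Equivalent γ ρ
Equivalent-sym {ρ} {γ} ρ-≡-listable γ-onto (φ , φ-recursive , γ≡ρ∘φ) =
  ψ , (program K , λ n → program⇓ K (n ∷ [])) , λ n → sym (trans (γ≡ρ∘φ (ψ n)) (proj₂ selected (n ∷ [])))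
  where
  Φ : Recursive 1
  Φ = fromTotalRecursive φ-recursive
  Hits : Vec ℕ 2 → Set
  Hits (k ∷ n ∷ []) = ρ (φ k) ≡ ρ n
  hits : SemiDecidable Hits
  hits = semidec-resp (λ { (k ∷ n ∷ []) h → h }) (λ { (k ∷ n ∷ []) h → h })
           (semidec-∘ (listable⇒semidec ρ-≡-listable) (`call Φ (v₀ ∷ []) ∷ v₁ ∷ [])
                      (λ { (k ∷ n ∷ []) → φ k ∷ n ∷ [] }) (λ { (k ∷ n ∷ []) → refl }))
  selected : Σ (Recursive 1) λ K → ∀ x → Hits (function K x ∷ x)
  selected = select hits (λ { (n ∷ []) → let (k , γk≡ρn) = γ-onto (ρ n) in k , trans (sym (γ≡ρ∘φ k)) γk≡ρn })
  K : Recursive 1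
  K = proj₁ selected
  ψ : ℕ → ℕ
  ψ n = function K (n ∷ [])

listable-pullback : ∀ {k} {ρ γ} (P : Vec ℚ k → Set) → Equivalent ρ γ →
                    Listable (λ v → P (map ρ v)) → Listable (λ v → P (map γ v))
listable-pullback {ρ = ρ} {γ} P (φ , φ-recursive , γ≡ρ∘φ) P∘ρ-listable =
  semidec⇒listable (semidec-cong P ρ∘φ≡γ
    (semidec-∘ (listable⇒semidec P∘ρ-listable) (`map Φ) (map φ) (⟦map⟧ Φ)))
  where
  Φ : Recursive 1
  Φ = fromTotalRecursive φ-recursive
  ρ∘φ≡γ : ∀ v → map ρ (map φ v) ≡ map γ v
  ρ∘φ≡γ v = trans (sym (map-∘ ρ φ v)) (map-cong (sym ∘ γ≡ρ∘φ) v)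

init-map : ∀ {A B : Set} {k} (f : A → B) (v : Vec A (suc k)) → init (map f v) ≡ map f (init v)
init-map {k = 0}     f (x ∷ []) = refl
init-map {k = suc k} f (x ∷ v)  = cong (f x ∷_) (init-map f v)

last-map : ∀ {A B : Set} {k} (f : A → B) (v : Vec A (suc k)) → last (map f v) ≡ f (last v)
last-map {k = 0}     f (x ∷ []) = refl
last-map {k = suc k} f (x ∷ v)  = last-map f v

presentation-transport : ∀ {L} {𝔔 : ℚStructure L} {ρ γ} → IsListablePresentation 𝔔 ρ → Equivalent ρ γ →
                         Surjective γ → IsListablePresentation 𝔔 γ
presentation-transport {L} {𝔔} {ρ} {γ} (_ , ≡-listable , rel-listable , fun-listable) ρ~γ γ-onto =
  γ-onto ,
  listable-resp (λ { (x ∷ y ∷ []) → ⇔.refl })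
    (listable-pullback Equal ρ~γ (listable-resp (λ { (x ∷ y ∷ []) → ⇔.refl }) ≡-listable)) ,
  (λ r → listable-pullback (relI 𝔔 r) ρ~γ (rel-listable r)) ,
  (λ f → listable-resp (⇔.sym ∘ graph f γ)
           (listable-pullback (Graph f) ρ~γ (listable-resp (graph f ρ) (fun-listable f))))
  where
  Equal : Vec ℚ 2 → Set
  Equal (a ∷ b ∷ []) = a ≡ b
  Graph : (f : Fun L) → Vec ℚ (suc (funArity L f)) → Set
  Graph f v = funI 𝔔 f (init v) ≡ last v
  graph : ∀ f (σ : ℕ → ℚ) v → (funI 𝔔 f (map σ (init v)) ≡ σ (last v)) ⇔ Graph f (map σ v)
  graph f σ v rewrite init-map σ v | last-map σ v = ⇔.refl

proposition3p31 : (L : Language) (𝔔 : ℚStructure L) →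
    HasListablePresentation 𝔔 →
    PEDefinable 𝔔 ZeroSet →
    PEDefinable 𝔔 GraphS →
    PEDefinable 𝔔 GraphR →
    UniquelyListable 𝔔 × IsListablePresentation 𝔔 τ
proposition3p31 L 𝔔 (ρ₀ , ρ₀-pres) 0-def S-def R-def = ((ρ₀ , ρ₀-pres) , unique) , τ-pres
  where
  ~τ : ∀ {ρ} → IsListablePresentation 𝔔 ρ → Equivalent ρ τ
  ~τ = Decoding.τ-equivalent 𝔔 0-def S-def R-def
  τ-pres : IsListablePresentation 𝔔 τ
  τ-pres = presentation-transport {𝔔 = 𝔔} ρ₀-pres (~τ {ρ₀} ρ₀-pres) τ-surjective
  unique : (ρ γ : ℕ → ℚ) → IsListablePresentation 𝔔 ρ → IsListablePresentation 𝔔 γ → Equivalent ρ γ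
  unique ρ γ ρ-pres γ-pres =
    Equivalent-trans {ρ} {τ} {γ} (~τ ρ-pres) (Equivalent-sym (proj₁ (proj₂ γ-pres)) τ-surjective (~τ γ-pres))
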